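{- Let $n$ be a positive integer and let $p$ be a prime with $p>\max(n+1,3)$. Then $$\sum_{i=1}^{p-1}\frac{(-1)^{p+i}\left(\frac{p+i}{3}\right)}{i^{n}}\equiv \begin{cases} -\dfrac{2^{n+1}+4}{n\,6^{n}}\,B_{p-n}\!\left(\dfrac13\right)\pmod p, & \text{if } n \text{ is even},\\[3mm] 0\pmod p, & \text{if } n \text{ is odd}. \end{cases}$$
   Context: For an integer $a$, $\left(\frac{a}{3}\right)$ is the Legendre symbol modulo $3$: it equals $0$ if $3\mid a$, $1$ if $a\equiv 1\pmod 3$, and $-1$ if $a\equiv 2\pmod 3$. The Bernoulli polynomials $B_m(x)$ are defined by $\frac{ze^{xz}}{e^z-1}=\sum_{m\ge 0}B_m(x)\frac{z^m}{m!}$. For rational numbers $a,b$, the congruence $a\equiv b\pmod p$ means that $a-b$ is $p$ times a rational number whose denominator is not divisible by $p$. -}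

module Defs where

open import Data.Nat as ℕ using (ℕ; zero; suc; NonZero)
open import Data.Nat.Divisibility using (_∣_)
open import Data.Nat.Combinatorics using (_C_)
open import Data.Integer as ℤ using (ℤ; +_; -[1+_])
open import Data.Rational as ℚ using (ℚ; _/_; ↧ₙ_)
open import Data.Fin using (Fin; toℕ)
open import Data.Vec using (Vec; []; _∷ʳ_; lookup)
open import Data.Product using (∃; _×_)
open import Relation.Binary.PropositionalEquality using (_≡_)
open import Relation.Nullary using (¬_)

infixr 8 _^ℚ_
_^ℚ_ : ℚ → ℕ → ℚ
q ^ℚ zero  = ℚ.1ℚ
q ^ℚ suc m = q ℚ.* (q ^ℚ m)

sumFin : (m : ℕ) → (Fin m → ℚ) → ℚ
sumFin zero    f = ℚ.0ℚ
sumFin (suc m) f = f Fin.zero ℚ.+ sumFin m (λ k → f (Fin.suc k))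
  where import Data.Fin as Fin

legendre3 : ℤ → ℤ
legendre3 a with a ℤ.%ℕ 3
... | 0 = + 0
... | 1 = + 1
... | _ = -[1+ 0 ]

negOnePow : ℕ → ℤ
negOnePow m = -[1+ 0 ] ℤ.^ m

-- Bernoulli polynomials B_m(x) via the identity obtained by multiplying the
-- generating function by (e^z - 1) and comparing coefficients of z^(m+1)/(m+1)!:
--   Σ_{k=0}^{m} C(m+1,k) B_k(x) = (m+1) x^m,   i.e.
--   B_m(x) = x^m - (1/(m+1)) Σ_{k<m} C(m+1,k) B_k(x).
bernStep : ℚ → (m : ℕ) → Vec ℚ m → ℚ
bernStep x m v =
  (x ^ℚ m) ℚ.- (((+ 1) / suc m) ℚ.*
     sumFin m (λ k → ((+ (suc m C toℕ k)) / 1) ℚ.* lookup v k))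

bernList : ℚ → (m : ℕ) → Vec ℚ m
bernList x zero    = []
bernList x (suc m) = bernList x m ∷ʳ bernStep x m (bernList x m)

bernoulliPoly : ℕ → ℚ → ℚ
bernoulliPoly m x = bernStep x m (bernList x m)

_≡_[modℚ_] : ℚ → ℚ → ℕ → Set
a ≡ b [modℚ p ] = ∃ λ (r : ℚ) → (a ℚ.- b ≡ ((+ p) / 1) ℚ.* r) × ¬ (p ∣ ↧ₙ r)

lhsSum : ℕ → ℕ → ℚ
lhsSum n p = sumFin (p ℕ.∸ 1) λ k →
  let i = suc (toℕ k) in
  ((negOnePow (p ℕ.+ i) ℤ.* legendre3 (+ (p ℕ.+ i))) / 1) ℚ.* (((+ 1) / i) ^ℚ n)

-- The sum consists of p-integral rationals, so the congruence is proved in ℤ modulo p, with 1/a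
-- represented by a^(p-2) and B_m recomputed from its recursion with these inverses. For even n let
-- m = p - n, which is odd. By Fermat 1/i^n ≡ i^(m-1), and T(j) = 6^(m-1) B_m(j/6) / m satisfies
-- T(j + 6) - T(j) ≡ j^(m-1). As (-1)^j (j/3) has period 6, the sum telescopes in each residue
-- class mod 6 to a combination of the values B_m(a/6), 0 ≤ a ≤ 6, and these reduce to B_m(1/3)
-- by the vanishing of odd Bernoulli numbers, the reflection B_m(1 - x) = -B_m(x) and the
-- duplication formula at x = 1/3. The difference equation of B_m follows from uniqueness of
-- solutions of the recursion; the reflection and duplication formulas follow because the
-- difference of the two sides is invariant under x ↦ x + 1. For odd n the substitution
-- i ↦ p - i turns the sum into its negative.

module Submission where

open import Data.Nat.Base using (ℕ; _<_)
open import Data.Nat.Primality using (Prime)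


module Sums where

  open import Data.Nat as ℕ using (ℕ; zero; suc; _<_; _∸_; z≤n; s≤s)
  import Data.Nat.Properties as ℕ
  open import Data.Integer hiding (suc; pred; _≤_; _<_; _≥_; _>_; _≤?_; _<?_)
  open import Data.Integer.Properties
  open import Relation.Binary.PropositionalEquality using (_≡_; refl; cong; cong₂; sym; trans; module ≡-Reasoning)
  open import Data.Integer.Tactic.RingSolver using (solve-∀)
  open ≡-Reasoning

  sumℤ : ℕ → (ℕ → ℤ) → ℤ
  sumℤ zero    f = 0ℤ
  sumℤ (suc n) f = f 0 + sumℤ n (λ i → f (suc i))

  sum-cong : ∀ n {f g : ℕ → ℤ} → (∀ i → i < n → f i ≡ g i) → sumℤ n f ≡ sumℤ n g
  sum-cong zero    f≡g = refl
  sum-cong (suc n) f≡g = cong₂ _+_ (f≡g 0 (s≤s z≤n)) (sum-cong n (λ i i<n → f≡g (suc i) (s≤s i<n)))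

  sum-ext : ∀ n {f g : ℕ → ℤ} → (∀ i → f i ≡ g i) → sumℤ n f ≡ sumℤ n g
  sum-ext n f≡g = sum-cong n (λ i _ → f≡g i)

  sum-snoc : ∀ n f → sumℤ (suc n) f ≡ sumℤ n f + f n
  sum-snoc zero    f = trans (+-identityʳ (f 0)) (sym (+-identityˡ (f 0)))
  sum-snoc (suc n) f = begin
    f 0 + sumℤ (suc n) (λ i → f (suc i))         ≡⟨ cong (_+_ (f 0)) (sum-snoc n (λ i → f (suc i))) ⟩
    f 0 + (sumℤ n (λ i → f (suc i)) + f (suc n)) ≡⟨ sym (+-assoc (f 0) _ _) ⟩
    f 0 + sumℤ n (λ i → f (suc i)) + f (suc n)   ∎

  sum-distrib-+ : ∀ n f g → sumℤ n (λ i → f i + g i) ≡ sumℤ n f + sumℤ n g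
  sum-distrib-+ zero    f g = refl
  sum-distrib-+ (suc n) f g = begin
    f 0 + g 0 + sumℤ n (λ i → f (suc i) + g (suc i))                  ≡⟨ cong (_+_ (f 0 + g 0)) (sum-distrib-+ n _ _) ⟩
    f 0 + g 0 + (sumℤ n (λ i → f (suc i)) + sumℤ n (λ i → g (suc i))) ≡⟨ interchange (f 0) (g 0) _ _ ⟩
    f 0 + sumℤ n (λ i → f (suc i)) + (g 0 + sumℤ n (λ i → g (suc i))) ∎
    where
    interchange : ∀ a b c d → a + b + (c + d) ≡ a + c + (b + d)
    interchange = solve-∀

  *-distribˡ-sum : ∀ n c f → sumℤ n (λ i → c * f i) ≡ c * sumℤ n f
  *-distribˡ-sum zero    c f = sym (*-zeroʳ c)
  *-distribˡ-sum (suc n) c f = trans (cong (_+_ (c * f 0)) (*-distribˡ-sum n c _)) (sym (*-distribˡ-+ c _ _))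

  neg-distrib-sum : ∀ n f → sumℤ n (λ i → - f i) ≡ - sumℤ n f
  neg-distrib-sum zero    f = refl
  neg-distrib-sum (suc n) f = trans (cong (_+_ (- f 0)) (neg-distrib-sum n _)) (sym (neg-distrib-+ (f 0) _))

  sum-split : ∀ a b f → sumℤ (a ℕ.+ b) f ≡ sumℤ a f + sumℤ b (λ i → f (a ℕ.+ i))
  sum-split zero    b f = sym (+-identityˡ _)
  sum-split (suc a) b f = trans (cong (_+_ (f 0)) (sum-split a b (λ i → f (suc i)))) (sym (+-assoc (f 0) _ _))

  sum-reverse : ∀ n f → sumℤ n f ≡ sumℤ n (λ i → f (n ∸ suc i))
  sum-reverse zero    f = refl
  sum-reverse (suc n) f = begin
    sumℤ (suc n) f                      ≡⟨ sum-snoc n f ⟩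
    sumℤ n f + f n                      ≡⟨ cong (_+ f n) (sum-reverse n f) ⟩
    sumℤ n (λ i → f (n ∸ suc i)) + f n  ≡⟨ +-comm _ (f n) ⟩
    f n + sumℤ n (λ i → f (n ∸ suc i))  ∎

  sum-triangle-swap : ∀ M (a : ℕ → ℕ → ℤ) →
    sumℤ M (λ k → sumℤ (suc k) (a k)) ≡ sumℤ M (λ j → sumℤ (M ∸ j) (λ l → a (j ℕ.+ l) j))
  sum-triangle-swap zero    a = refl
  sum-triangle-swap (suc M) a = begin
    sumℤ (suc M) (λ k → sumℤ (suc k) (a k))                 ≡⟨ sum-snoc M _ ⟩
    sumℤ M (λ k → sumℤ (suc k) (a k)) + sumℤ (suc M) (a M)  ≡⟨ cong₂ _+_ (sum-triangle-swap M a) (sum-snoc M (a M)) ⟩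
    columns M + (sumℤ M (a M) + a M M)                      ≡⟨ sym (+-assoc (columns M) _ _) ⟩
    columns M + sumℤ M (a M) + a M M                        ≡⟨ cong₂ _+_ (sym (sum-distrib-+ M _ _)) last-column ⟩
    sumℤ M (λ j → column M j + a M j) + column (suc M) M    ≡⟨ cong (_+ column (suc M) M) (sum-cong M extend-column) ⟩
    sumℤ M (column (suc M)) + column (suc M) M              ≡⟨ sym (sum-snoc M (column (suc M))) ⟩
    sumℤ (suc M) (column (suc M))                           ∎
    where
    column : ℕ → ℕ → ℤ
    column M j = sumℤ (M ∸ j) (λ l → a (j ℕ.+ l) j)

    columns : ℕ → ℤ
    columns M = sumℤ M (column M)

    last-column : a M M ≡ column (suc M) M
    last-column = begin
      a M M                               ≡⟨ cong (λ z → a z M) (sym (ℕ.+-identityʳ M)) ⟩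
      a (M ℕ.+ 0) M                       ≡⟨ sym (+-identityʳ _) ⟩
      sumℤ 1 (λ l → a (M ℕ.+ l) M)        ≡⟨ cong (λ L → sumℤ L (λ l → a (M ℕ.+ l) M)) (sym (ℕ.m+n∸n≡m 1 M)) ⟩
      column (suc M) M                    ∎

    extend-column : ∀ j → j < M → column M j + a M j ≡ column (suc M) j
    extend-column j j<M = begin
      sumℤ (M ∸ j) g + a M j       ≡⟨ cong (λ z → sumℤ (M ∸ j) g + a z j) (sym (ℕ.m+[n∸m]≡n (ℕ.<⇒≤ j<M))) ⟩
      sumℤ (M ∸ j) g + g (M ∸ j)   ≡⟨ sym (sum-snoc (M ∸ j) g) ⟩
      sumℤ (suc (M ∸ j)) g         ≡⟨ cong (λ L → sumℤ L g) (sym (ℕ.+-∸-assoc 1 (ℕ.<⇒≤ j<M))) ⟩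
      sumℤ (suc M ∸ j) g           ∎
      where
      g : ℕ → ℤ
      g l = a (j ℕ.+ l) j


module IntegerPowers where

  open import Data.Nat as ℕ using (ℕ; zero; suc; s≤s)
  open import Data.Nat.DivMod using (m%n<n; m≡m%n+[m/n]*n)
  open import Data.Nat.Divisibility using (_∣_; divides)
  open import Data.Empty using (⊥-elim)
  open import Relation.Nullary using (¬_)
  open import Data.Integer hiding (suc; pred; _≤_; _<_; _≥_; _>_; _≤?_; _<?_)
  open import Data.Integer.Properties
  open import Relation.Binary.PropositionalEquality using (_≡_; refl; cong; sym; trans)
  open import Data.Integer.Tactic.RingSolver using (solve-∀)

  ^-distribʳ-* : ∀ a b n → (a * b) ^ n ≡ a ^ n * b ^ n
  ^-distribʳ-* a b zero    = refl
  ^-distribʳ-* a b (suc n) = trans (cong ((a * b) *_) (^-distribʳ-* a b n)) (interchange a b (a ^ n) (b ^ n))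
    where
    interchange : ∀ a b c d → a * b * (c * d) ≡ a * c * (b * d)
    interchange = solve-∀

  pos-^ : ∀ a b → + (a ℕ.^ b) ≡ (+ a) ^ b
  pos-^ a zero    = refl
  pos-^ a (suc b) = trans (pos-* a (a ℕ.^ b)) (cong (+ a *_) (pos-^ a b))

  [-1]^ : ℕ → ℤ
  [-1]^ k = -1ℤ ^ k

  [-1]^-+ : ∀ a b → [-1]^ (a ℕ.+ b) ≡ [-1]^ a * [-1]^ b
  [-1]^-+ = ^-distribˡ-+-* -1ℤ

  [-1]^-even : ∀ {n} → 2 ∣ n → [-1]^ n ≡ 1ℤ
  [-1]^-even (divides j refl) = [-1]^[j*2]≡1 j
    where
    [-1]^[j*2]≡1 : ∀ j → [-1]^ (j ℕ.* 2) ≡ 1ℤ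
    [-1]^[j*2]≡1 zero    = refl
    [-1]^[j*2]≡1 (suc j) = trans (sym (*-assoc -1ℤ -1ℤ ([-1]^ (j ℕ.* 2)))) (trans (*-identityˡ _) ([-1]^[j*2]≡1 j))

  [-1]^-odd : ∀ n → ¬ (2 ∣ n) → [-1]^ n ≡ -1ℤ
  [-1]^-odd n 2∤n with n ℕ.% 2 | m%n<n n 2 | m≡m%n+[m/n]*n n 2
  ... | 0           | _                 | n≡ = ⊥-elim (2∤n (divides (n ℕ./ 2) n≡))
  ... | 1           | _                 | n≡ = trans (cong [-1]^ n≡) (cong (-1ℤ *_) ([-1]^-even (divides (n ℕ./ 2) refl)))
  ... | suc (suc _) | s≤s (s≤s ())      | _

  neg-^ : ∀ x j → (- x) ^ j ≡ [-1]^ j * x ^ j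
  neg-^ x j = trans (cong (_^ j) (sym (-1*i≡-i x))) (^-distribʳ-* -1ℤ x j)


module BinomialCoefficients where

  open import Data.Nat using (suc; _≤_; _∸_; s≤s; _!; _+_; _*_)
  open import Data.Nat.Properties
  open import Data.Nat.Combinatorics using (_C_; nCk≡n!/k![n-k]!; k![n∸k]!∣n!; k>n⇒nCk≡0; nCk≡nC[n∸k]; nC1≡n)
  open import Data.Nat.DivMod using (m/n*n≡m)
  open import Data.Nat.Tactic.RingSolver using (solve-∀)
  open import Relation.Binary.PropositionalEquality using (_≡_; cong; sym; trans; subst; module ≡-Reasoning)
  open import Data.Sum using (inj₁; inj₂)
  open ≡-Reasoning

  nCk*[k!*[n∸k]!]≡n! : ∀ {n k} → k ≤ n → (n C k) * (k ! * (n ∸ k) !) ≡ n !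
  nCk*[k!*[n∸k]!]≡n! {n} {k} k≤n =
    trans (cong (_* (k ! * (n ∸ k) !)) (nCk≡n!/k![n-k]! k≤n)) (m/n*n≡m (k![n∸k]!∣n! k≤n))
    where instance _ = k !* (n ∸ k) !≢0

  [1+k]*[1+n]C[1+k]≡[1+n]*nCk : ∀ n k → suc k * (suc n C suc k) ≡ suc n * (n C k)
  [1+k]*[1+n]C[1+k]≡[1+n]*nCk n k with ≤-<-connex k n
  ... | inj₁ k≤n = *-cancelʳ-≡ _ _ (k ! * (n ∸ k) !) (begin
        suc k * (suc n C suc k) * (k ! * (n ∸ k) !)  ≡⟨ regroup (suc k) (suc n C suc k) (k !) ((n ∸ k) !) ⟩
        (suc n C suc k) * (suc k ! * (n ∸ k) !)     ≡⟨ nCk*[k!*[n∸k]!]≡n! (s≤s k≤n) ⟩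
        suc n !                                      ≡⟨ cong (suc n *_) (sym (nCk*[k!*[n∸k]!]≡n! k≤n)) ⟩
        suc n * ((n C k) * (k ! * (n ∸ k) !))        ≡⟨ sym (*-assoc (suc n) (n C k) _) ⟩
        suc n * (n C k) * (k ! * (n ∸ k) !)          ∎)
    where
    instance _ = k !* (n ∸ k) !≢0
    regroup : ∀ a b c d → a * b * (c * d) ≡ b * ((a * c) * d)
    regroup = solve-∀
  ... | inj₂ n<k rewrite k>n⇒nCk≡0 n<k | k>n⇒nCk≡0 (s≤s n<k) =
    trans (*-zeroʳ (suc k)) (sym (*-zeroʳ (suc n)))

  nC[j+l]*[j+l]Cj≡nCj*[n∸j]Cl : ∀ n j l → j + l ≤ n → (n C (j + l)) * ((j + l) C j) ≡ (n C j) * ((n ∸ j) C l)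
  nC[j+l]*[j+l]Cj≡nCj*[n∸j]Cl n j l j+l≤n = *-cancelʳ-≡ _ _ (j ! * l ! * e) (begin
      (n C (j + l)) * ((j + l) C j) * (j ! * l ! * e)   ≡⟨ regroup₁ (n C (j + l)) ((j + l) C j) (j !) (l !) e ⟩
      (n C (j + l)) * (((j + l) C j) * (j ! * l !) * e) ≡⟨ cong (λ z → (n C (j + l)) * (z * e)) split-j+l ⟩
      (n C (j + l)) * ((j + l) ! * e)                   ≡⟨ nCk*[k!*[n∸k]!]≡n! j+l≤n ⟩
      n !                                               ≡⟨ sym (nCk*[k!*[n∸k]!]≡n! j≤n) ⟩
      (n C j) * (j ! * (n ∸ j) !)                       ≡⟨ cong (λ z → (n C j) * (j ! * z)) (sym split-n∸j) ⟩
      (n C j) * (j ! * (((n ∸ j) C l) * (l ! * e)))     ≡⟨ regroup₂ (n C j) ((n ∸ j) C l) (j !) (l !) e ⟩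
      (n C j) * ((n ∸ j) C l) * (j ! * l ! * e)         ∎)
    where
    e = (n ∸ (j + l)) !
    instance _ = m*n≢0 (j ! * l !) e {{j !* l !≢0}} {{(n ∸ (j + l)) !≢0}}
    j≤n : j ≤ n
    j≤n = m+n≤o⇒m≤o j j+l≤n
    l≤n∸j : l ≤ n ∸ j
    l≤n∸j = m+n≤o⇒m≤o∸n l (subst (_≤ n) (+-comm j l) j+l≤n)
    split-j+l : ((j + l) C j) * (j ! * l !) ≡ (j + l) !
    split-j+l = subst (λ z → ((j + l) C j) * (j ! * z !) ≡ (j + l) !) (m+n∸m≡n j l) (nCk*[k!*[n∸k]!]≡n! (m≤m+n j l))
    split-n∸j : ((n ∸ j) C l) * (l ! * e) ≡ (n ∸ j) !
    split-n∸j = subst (λ z → ((n ∸ j) C l) * (l ! * z !) ≡ (n ∸ j) !) (∸-+-assoc n j l) (nCk*[k!*[n∸k]!]≡n! l≤n∸j)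
    regroup₁ : ∀ a b c d e → a * b * (c * d * e) ≡ a * (b * (c * d) * e)
    regroup₁ = solve-∀
    regroup₂ : ∀ a b c d e → a * (c * (b * (d * e))) ≡ a * b * (c * d * e)
    regroup₂ = solve-∀

  [1+m]Cm≡1+m : ∀ m → suc m C m ≡ suc m
  [1+m]Cm≡1+m m = trans (nCk≡nC[n∸k] (n≤1+n m)) (trans (cong (suc m C_) (m+n∸n≡m 1 m)) (nC1≡n (suc m)))


module BinomialTheorem where

  open import Data.Nat as ℕ using (ℕ; zero; suc; _∸_)
  import Data.Nat.Properties as ℕ
  open import Data.Nat.Combinatorics using (_C_; k>n⇒nCk≡0; nCk+nC[k+1]≡[n+1]C[k+1]; nCn≡1)
  open import Data.Integer hiding (suc; pred; _≤_; _<_; _≥_; _>_; _≤?_; _<?_)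
  open import Data.Integer.Properties
  open import Relation.Binary.PropositionalEquality using (_≡_; refl; cong; cong₂; sym; trans; module ≡-Reasoning)
  open import Data.Integer.Tactic.RingSolver using (solve-∀)
  open ≡-Reasoning
  open Sums
  open BinomialCoefficients
  open IntegerPowers

  binomialℤ : ℕ → ℕ → ℤ
  binomialℤ n k = + (n C k)

  binomial-theorem : ∀ x n → (x + 1ℤ) ^ n ≡ sumℤ (suc n) (λ j → binomialℤ n j * x ^ j)
  binomial-theorem x zero    = refl
  binomial-theorem x (suc n) = begin
    (x + 1ℤ) * (x + 1ℤ) ^ n                ≡⟨ cong ((x + 1ℤ) *_) (binomial-theorem x n) ⟩
    (x + 1ℤ) * S                           ≡⟨ *-distribʳ-+ S x 1ℤ ⟩
    x * S + 1ℤ * S                         ≡⟨ cong₂ _+_ x*S (*-identityˡ S) ⟩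
    U + (binomialℤ n 0 * 1ℤ + T)           ≡⟨ rearrange U T ⟩
    1ℤ + (U + (T + 0ℤ))                    ≡⟨ cong (λ z → 1ℤ + (U + z)) (sym V≡T+0) ⟩
    1ℤ + (U + V)                           ≡⟨ cong (_+_ 1ℤ) (sym (sum-distrib-+ (suc n) (λ j → binomialℤ n j * x ^ suc j) (λ j → binomialℤ n (suc j) * x ^ suc j))) ⟩
    1ℤ + sumℤ (suc n) (λ j → binomialℤ n j * x ^ suc j + binomialℤ n (suc j) * x ^ suc j)
                                           ≡⟨ cong (_+_ 1ℤ) (sum-ext (suc n) pascal) ⟩
    1ℤ + sumℤ (suc n) (λ j → binomialℤ (suc n) (suc j) * x ^ suc j) ∎
    where
    S = sumℤ (suc n) (λ j → binomialℤ n j * x ^ j)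
    U = sumℤ (suc n) (λ j → binomialℤ n j * x ^ suc j)
    T = sumℤ n (λ j → binomialℤ n (suc j) * x ^ suc j)
    V = sumℤ (suc n) (λ j → binomialℤ n (suc j) * x ^ suc j)
    swap : ∀ a b c → a * (b * c) ≡ b * (a * c)
    swap = solve-∀
    x*S : x * S ≡ U
    x*S = trans (sym (*-distribˡ-sum (suc n) x (λ j → binomialℤ n j * x ^ j))) (sum-ext (suc n) (λ j → swap x (binomialℤ n j) (x ^ j)))
    V≡T+0 : V ≡ T + 0ℤ
    V≡T+0 = trans (sum-snoc n _) (cong (_+_ T)
      (trans (cong (λ z → + z * x ^ suc n) (k>n⇒nCk≡0 (ℕ.n<1+n n))) (*-zeroˡ (x ^ suc n))))
    rearrange : ∀ U T → U + (1ℤ * 1ℤ + T) ≡ 1ℤ + (U + (T + 0ℤ))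
    rearrange = solve-∀
    pascal : ∀ j → binomialℤ n j * x ^ suc j + binomialℤ n (suc j) * x ^ suc j ≡ binomialℤ (suc n) (suc j) * x ^ suc j
    pascal j = trans (sym (*-distribʳ-+ (x ^ suc j) (binomialℤ n j) (binomialℤ n (suc j))))
                     (cong (λ z → + z * x ^ suc j) (nCk+nC[k+1]≡[n+1]C[k+1] n j))

  alternating-binomial-sum : ∀ N → sumℤ (suc N) (λ l → binomialℤ (suc N) l * [-1]^ l) ≡ - [-1]^ (suc N)
  alternating-binomial-sum N = begin
      X                                 ≡⟨ cancel X ([-1]^ (suc N)) ⟩
      (X + [-1]^ (suc N)) - [-1]^ (suc N) ≡⟨ cong (_- [-1]^ (suc N)) (sym 0≡X+last) ⟩
      0ℤ - [-1]^ (suc N)                ≡⟨ +-identityˡ _ ⟩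
      - [-1]^ (suc N)                   ∎
    where
    X = sumℤ (suc N) (λ l → binomialℤ (suc N) l * [-1]^ l)
    cancel : ∀ X Y → X ≡ (X + Y) - Y
    cancel = solve-∀
    0≡X+last : 0ℤ ≡ X + [-1]^ (suc N)
    0≡X+last = trans (binomial-theorem -1ℤ (suc N)) (trans (sum-snoc (suc N) (λ l → binomialℤ (suc N) l * [-1]^ l))
      (cong (_+_ X) (trans (cong (λ z → + z * [-1]^ (suc N)) (nCn≡1 (suc N))) (*-identityˡ ([-1]^ (suc N))))))

  alternating-subset-sum : ∀ m j → j ℕ.≤ m →
    sumℤ (suc m ∸ j) (λ l → binomialℤ (suc m) (j ℕ.+ l) * binomialℤ (j ℕ.+ l) j * [-1]^ (j ℕ.+ l)) ≡ [-1]^ m * binomialℤ (suc m) j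
  alternating-subset-sum m j j≤m = begin
      sumℤ (suc m ∸ j) term                                   ≡⟨ cong (λ L → sumℤ L term) 1+m∸j≡1+N ⟩
      sumℤ (suc N) term                                       ≡⟨ sum-cong (suc N) factor ⟩
      sumℤ (suc N) (λ l → K * (binomialℤ (suc N) l * [-1]^ l)) ≡⟨ *-distribˡ-sum (suc N) K (λ l → binomialℤ (suc N) l * [-1]^ l) ⟩
      K * sumℤ (suc N) (λ l → binomialℤ (suc N) l * [-1]^ l)   ≡⟨ cong (K *_) (alternating-binomial-sum N) ⟩
      K * - [-1]^ (suc N)                                     ≡⟨ regroup-sign c ([-1]^ j) ([-1]^ (suc N)) ⟩
      - (c * ([-1]^ j * [-1]^ (suc N)))                       ≡⟨ cong (λ s → - (c * s)) (trans (sym ([-1]^-+ j (suc N))) (cong [-1]^ j+1+N≡1+m)) ⟩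
      - (c * [-1]^ (suc m))                                   ≡⟨ flip-sign ([-1]^ m) c ⟩
      [-1]^ m * c                                             ∎
    where
    N = m ∸ j
    c = binomialℤ (suc m) j
    K = c * [-1]^ j
    term : ℕ → ℤ
    term l = binomialℤ (suc m) (j ℕ.+ l) * binomialℤ (j ℕ.+ l) j * [-1]^ (j ℕ.+ l)
    1+m∸j≡1+N : suc m ∸ j ≡ suc N
    1+m∸j≡1+N = ℕ.+-∸-assoc 1 j≤m
    j+1+N≡1+m : j ℕ.+ suc N ≡ suc m
    j+1+N≡1+m = trans (ℕ.+-suc j N) (cong suc (ℕ.m+[n∸m]≡n j≤m))
    regroup-sign : ∀ c a b → c * a * - b ≡ - (c * (a * b))
    regroup-sign = solve-∀
    flip-sign : ∀ s c → - (c * (-1ℤ * s)) ≡ s * c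
    flip-sign = solve-∀
    regroup : ∀ a b c d → a * b * (c * d) ≡ a * c * (b * d)
    regroup = solve-∀
    factor : ∀ l → l ℕ.< suc N → term l ≡ K * (binomialℤ (suc N) l * [-1]^ l)
    factor l l<1+N = begin
      term l                                                          ≡⟨ cong (_* [-1]^ (j ℕ.+ l)) (sym (pos-* (suc m C (j ℕ.+ l)) ((j ℕ.+ l) C j))) ⟩
      + ((suc m C (j ℕ.+ l)) ℕ.* ((j ℕ.+ l) C j)) * [-1]^ (j ℕ.+ l) ≡⟨ cong₂ (λ c s → + c * s) (nC[j+l]*[j+l]Cj≡nCj*[n∸j]Cl (suc m) j l j+l≤1+m) ([-1]^-+ j l) ⟩
      + ((suc m C j) ℕ.* ((suc m ∸ j) C l)) * ([-1]^ j * [-1]^ l)     ≡⟨ cong (λ L → + ((suc m C j) ℕ.* (L C l)) * ([-1]^ j * [-1]^ l)) 1+m∸j≡1+N ⟩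
      + ((suc m C j) ℕ.* (suc N C l)) * ([-1]^ j * [-1]^ l)           ≡⟨ cong (_* ([-1]^ j * [-1]^ l)) (pos-* (suc m C j) (suc N C l)) ⟩
      binomialℤ (suc m) j * binomialℤ (suc N) l * ([-1]^ j * [-1]^ l) ≡⟨ regroup (binomialℤ (suc m) j) (binomialℤ (suc N) l) ([-1]^ j) ([-1]^ l) ⟩
      K * (binomialℤ (suc N) l * [-1]^ l)                             ∎
      where
      j+l≤1+m : j ℕ.+ l ℕ.≤ suc m
      j+l≤1+m = ℕ.≤-trans (ℕ.+-monoʳ-≤ j (ℕ.<⇒≤ l<1+N)) (ℕ.≤-reflexive j+1+N≡1+m)


module Congruence (p : ℕ) where

  open import Data.Nat as ℕ using (zero; suc)
  import Data.Nat.Properties as ℕ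
  import Data.Nat.Divisibility as ℕ
  open import Data.Nat.Primality using (Prime; euclidsLemma)
  open import Data.Integer hiding (suc; pred; _≤_; _<_; _≥_; _>_; _≤?_; _<?_)
  open import Data.Integer.Properties
  open import Data.Product using (_,_)
  open import Data.Sum using (inj₁; inj₂)
  open import Data.Empty using (⊥-elim)
  open import Relation.Nullary using (¬_)
  open import Relation.Binary.PropositionalEquality as ≡ using (_≡_; refl; cong; cong₂; sym; trans)
  open import Relation.Binary.Structures using (IsEquivalence)
  open import Relation.Binary.Bundles using (Setoid)
  import Relation.Binary.Reasoning.Setoid as SetoidReasoning
  open import Algebra.Structures using (IsCommutativeRing)
  open import Level using (0ℓ)
  open import Data.Integer.Tactic.RingSolver using (solve-∀)
  open import Data.Nat.Tactic.RingSolver using () renaming (solve-∀ to ℕ-solve-∀)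
  open Sums

  infix 4 _≈_
  record _≈_ (a b : ℤ) : Set where
    constructor mk
    field
      quotient   : ℤ
      difference : a - b ≡ quotient * + p

  ≈-refl : ∀ {a} → a ≈ a
  ≈-refl {a} = mk 0ℤ (+-inverseʳ a)

  ≡⇒≈ : ∀ {a b} → a ≡ b → a ≈ b
  ≡⇒≈ refl = ≈-refl

  ≈-sym : ∀ {a b} → a ≈ b → b ≈ a
  ≈-sym {a} {b} (mk k e) = mk (- k) (≡.trans (flip a b) (≡.trans (cong -_ e) (neg-distribˡ-* k (+ p))))
    where
    flip : ∀ a b → b - a ≡ - (a - b)
    flip = solve-∀

  ≈-trans : ∀ {a b c} → a ≈ b → b ≈ c → a ≈ c
  ≈-trans {a} {b} {c} (mk k e) (mk l f) =
    mk (k + l) (≡.trans (telescope a b c) (≡.trans (cong₂ _+_ e f) (≡.sym (*-distribʳ-+ (+ p) k l))))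
    where
    telescope : ∀ a b c → a - c ≡ (a - b) + (b - c)
    telescope = solve-∀

  +-cong-≈ : ∀ {a b c d} → a ≈ b → c ≈ d → a + c ≈ b + d
  +-cong-≈ {a} {b} {c} {d} (mk k e) (mk l f) =
    mk (k + l) (≡.trans (regroup a b c d) (≡.trans (cong₂ _+_ e f) (≡.sym (*-distribʳ-+ (+ p) k l))))
    where
    regroup : ∀ a b c d → (a + c) - (b + d) ≡ (a - b) + (c - d)
    regroup = solve-∀

  *-cong-≈ : ∀ {a b c d} → a ≈ b → c ≈ d → a * c ≈ b * d
  *-cong-≈ {a} {b} {c} {d} (mk k e) (mk l f) =
    mk (a * l + k * d) (≡.trans (split a b c d) (≡.trans (cong₂ (λ u v → a * u + v * d) f e) (collect a l k d (+ p))))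
    where
    split : ∀ a b c d → (a * c) - (b * d) ≡ a * (c - d) + (a - b) * d
    split = solve-∀
    collect : ∀ a l k d q → a * (l * q) + k * q * d ≡ (a * l + k * d) * q
    collect = solve-∀

  neg-cong-≈ : ∀ {a b} → a ≈ b → - a ≈ - b
  neg-cong-≈ {a} {b} (mk k e) = mk (- k) (≡.trans (regroup a b) (≡.trans (cong -_ e) (neg-distribˡ-* k (+ p))))
    where
    regroup : ∀ a b → - a - - b ≡ - (a - b)
    regroup = solve-∀

  isCommutativeRing : IsCommutativeRing _≈_ _+_ _*_ -_ 0ℤ 1ℤ
  isCommutativeRing = record
    { isRing = record
      { +-isAbelianGroup = record
        { isGroup = record
          { isMonoid = record
            { isSemigroup = record
              { isMagma = record { isEquivalence = isEquivalence ; ∙-cong = +-cong-≈ }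
              ; assoc = λ x y z → ≡⇒≈ (+-assoc x y z) }
            ; identity = (λ x → ≡⇒≈ (+-identityˡ x)) , (λ x → ≡⇒≈ (+-identityʳ x)) }
          ; inverse = (λ x → ≡⇒≈ (+-inverseˡ x)) , (λ x → ≡⇒≈ (+-inverseʳ x))
          ; ⁻¹-cong = neg-cong-≈ }
        ; comm = λ x y → ≡⇒≈ (+-comm x y) }
      ; *-cong = *-cong-≈
      ; *-assoc = λ x y z → ≡⇒≈ (*-assoc x y z)
      ; *-identity = (λ x → ≡⇒≈ (*-identityˡ x)) , (λ x → ≡⇒≈ (*-identityʳ x))
      ; distrib = (λ x y z → ≡⇒≈ (*-distribˡ-+ x y z)) , (λ x y z → ≡⇒≈ (*-distribʳ-+ x y z)) }
    ; *-comm = λ x y → ≡⇒≈ (*-comm x y) }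
    where
    isEquivalence : IsEquivalence _≈_
    isEquivalence = record { refl = ≈-refl ; sym = ≈-sym ; trans = ≈-trans }

  setoid : Setoid 0ℓ 0ℓ
  setoid = record { isEquivalence = IsCommutativeRing.isEquivalence isCommutativeRing }

  module ≈-Reasoning = SetoidReasoning setoid

  ^-cong-≈ : ∀ {a b} n → a ≈ b → a ^ n ≈ b ^ n
  ^-cong-≈ zero    a≈b = ≈-refl
  ^-cong-≈ (suc n) a≈b = *-cong-≈ a≈b (^-cong-≈ n a≈b)

  p≈0 : + p ≈ 0ℤ
  p≈0 = mk 1ℤ (≡.trans (+-identityʳ (+ p)) (≡.sym (*-identityˡ (+ p))))

  *-cancelˡ-≈ : ∀ {c d a b} → d * c ≈ 1ℤ → c * a ≈ c * b → a ≈ b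
  *-cancelˡ-≈ {c} {d} {a} {b} d*c≈1 c*a≈c*b = begin
      a            ≈⟨ ≈-sym (unit a) ⟩
      d * c * a    ≡⟨ *-assoc d c a ⟩
      d * (c * a)  ≈⟨ *-cong-≈ (≈-refl {d}) c*a≈c*b ⟩
      d * (c * b)  ≡⟨ ≡.sym (*-assoc d c b) ⟩
      d * c * b    ≈⟨ unit b ⟩
      b            ∎
    where
    open ≈-Reasoning
    unit : ∀ x → d * c * x ≈ x
    unit x = ≈-trans (*-cong-≈ d*c≈1 (≈-refl {x})) (≡⇒≈ (*-identityˡ x))

  sum-cong-≈ : ∀ n {f g : ℕ → ℤ} → (∀ i → i ℕ.< n → f i ≈ g i) → sumℤ n f ≈ sumℤ n g
  sum-cong-≈ zero    f≈g = ≈-refl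
  sum-cong-≈ (suc n) f≈g = +-cong-≈ (f≈g 0 (ℕ.s≤s ℕ.z≤n)) (sum-cong-≈ n (λ i i<n → f≈g (suc i) (ℕ.s≤s i<n)))

  sum-≈0 : ∀ n {f : ℕ → ℤ} → (∀ i → i ℕ.< n → f i ≈ 0ℤ) → sumℤ n f ≈ 0ℤ
  sum-≈0 zero    f≈0 = ≈-refl
  sum-≈0 (suc n) f≈0 = +-cong-≈ (f≈0 0 (ℕ.s≤s ℕ.z≤n)) (sum-≈0 n (λ i i<n → f≈0 (suc i) (ℕ.s≤s i<n)))

  x-y≈0⇒x≈y : ∀ {a b} → a - b ≈ 0ℤ → a ≈ b
  x-y≈0⇒x≈y {a} {b} (mk k e) = mk k (≡.trans (≡.sym (+-identityʳ (a - b))) e)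

  x≈y⇒x-y≈0 : ∀ {a b} → a ≈ b → a - b ≈ 0ℤ
  x≈y⇒x-y≈0 {a} {b} (mk k e) = mk k (≡.trans (+-identityʳ (a - b)) e)

  ∣⇒≈0 : ∀ {z} → p ℕ.∣ ∣ z ∣ → z ≈ 0ℤ
  ∣⇒≈0 {+ n}      (ℕ.divides q e) = mk (+ q) (≡.trans (+-identityʳ (+ n)) (≡.trans (cong +_ e) (pos-* q p)))
  ∣⇒≈0 { -[1+ n ]} (ℕ.divides q e) = mk (- (+ q))
    (≡.trans (cong (λ z → - (+ z)) e) (≡.trans (cong -_ (pos-* q p)) (neg-distribˡ-* (+ q) (+ p))))

  ≈0⇒∣ : ∀ {z} → z ≈ 0ℤ → p ℕ.∣ ∣ z ∣
  ≈0⇒∣ {z} (mk k e) = ℕ.divides ∣ k ∣ (≡.trans (cong ∣_∣ (≡.trans (≡.sym (+-identityʳ z)) e)) (abs-* k (+ p)))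

  euclid-≈0 : Prime p → ∀ {a b} → a * b ≈ 0ℤ → ¬ (p ℕ.∣ ∣ a ∣) → b ≈ 0ℤ
  euclid-≈0 p-prime {a} {b} ab≈0 p∤a with euclidsLemma ∣ a ∣ ∣ b ∣ p-prime (≡.subst (p ℕ.∣_) (abs-* a b) (≈0⇒∣ ab≈0))
  ... | inj₁ p∣a = ⊥-elim (p∤a p∣a)
  ... | inj₂ p∣b = ∣⇒≈0 p∣b

  +-cancelˡ-≈ : ∀ {a a' x y} → a + x ≈ a' + y → a ≈ a' → x ≈ y
  +-cancelˡ-≈ {a} {a'} {x} {y} a+x≈a'+y a≈a' = begin
      x             ≡⟨ cancel a x ⟩
      (a + x) - a   ≈⟨ +-cong-≈ a+x≈a'+y (neg-cong-≈ a≈a') ⟩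
      (a' + y) - a' ≡⟨ ≡.sym (cancel a' y) ⟩
      y             ∎
    where
    open ≈-Reasoning
    cancel : ∀ a x → x ≡ (a + x) - a
    cancel = solve-∀

  x+y≈0⇒x≈-y : ∀ {a b} → a + b ≈ 0ℤ → a ≈ - b
  x+y≈0⇒x≈-y {a} {b} a+b≈0 = begin
      a            ≡⟨ cancel a b ⟩
      (a + b) - b  ≈⟨ +-cong-≈ a+b≈0 (≈-refl { - b}) ⟩
      0ℤ - b       ≡⟨ +-identityˡ (- b) ⟩
      - b          ∎
    where
    open ≈-Reasoning
    cancel : ∀ a b → a ≡ (a + b) - b
    cancel = solve-∀

  shift-invariant⇒constant : (F : ℤ → ℤ) → (∀ x → F (x + 1ℤ) ≈ F x) → ∀ x → F x ≈ F 0ℤ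
  shift-invariant⇒constant F invariant (+ zero)    = ≈-refl
  shift-invariant⇒constant F invariant (+ suc n)   =
    ≈-trans (≡⇒≈ (cong F (≡.trans (cong +_ (ℕ.+-comm 1 n)) (pos-+ n 1))))
            (≈-trans (invariant (+ n)) (shift-invariant⇒constant F invariant (+ n)))
  shift-invariant⇒constant F invariant -[1+ zero ]  = ≈-sym (invariant -1ℤ)
  shift-invariant⇒constant F invariant -[1+ suc n ] = ≈-trans (≈-sym (invariant -[1+ suc n ])) (shift-invariant⇒constant F invariant -[1+ n ])

  p+c≈c : ∀ c → + (p ℕ.+ c) ≈ + c
  p+c≈c c = ≈-trans (≡⇒≈ (pos-+ p c)) (≈-trans (+-cong-≈ p≈0 (≈-refl {+ c})) (≡⇒≈ (+-identityˡ (+ c))))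

  -- Summation by parts: each residue class mod d telescopes.
  periodic-telescoping : ∀ d (f h T : ℕ → ℤ) → (∀ j → f (j ℕ.+ d) ≡ f j) → (∀ j → T (j ℕ.+ d) ≈ T j + h j) →
    ∀ K A → sumℤ (K ℕ.* d) (λ i → f (A ℕ.+ i) * h (A ℕ.+ i))
            ≈ sumℤ d (λ a → f (A ℕ.+ a) * (T (A ℕ.+ a ℕ.+ K ℕ.* d) - T (A ℕ.+ a)))
  periodic-telescoping d f h T f-periodic T-step = go
    where
    G : ℕ → ℤ
    G i = f i * h i
    Φ : ℕ → ℕ → ℤ
    Φ A K = sumℤ d (λ a → f (A ℕ.+ a) * (T (A ℕ.+ a ℕ.+ K ℕ.* d) - T (A ℕ.+ a)))
    shift : ∀ A a → A ℕ.+ d ℕ.+ a ≡ A ℕ.+ a ℕ.+ d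
    shift A a = swap A a d
      where
      swap : ∀ A a d → A ℕ.+ d ℕ.+ a ≡ A ℕ.+ a ℕ.+ d
      swap = ℕ-solve-∀
    shift-end : ∀ A a K → A ℕ.+ d ℕ.+ a ℕ.+ K ℕ.* d ≡ A ℕ.+ a ℕ.+ suc K ℕ.* d
    shift-end A a K = regroup A a K d
      where
      regroup : ∀ A a K d → A ℕ.+ d ℕ.+ a ℕ.+ K ℕ.* d ≡ A ℕ.+ a ℕ.+ (d ℕ.+ K ℕ.* d)
      regroup = ℕ-solve-∀
    telescope : ∀ F u v w → F * (u - v) + F * (w - u) ≡ F * (w - v)
    telescope = solve-∀
    cancel : ∀ a b → a + b - a ≡ b
    cancel = solve-∀
    go : ∀ K A → sumℤ (K ℕ.* d) (λ i → G (A ℕ.+ i)) ≈ Φ A K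
    go zero    A = ≈-sym (sum-≈0 d (λ a _ → ≡⇒≈ (trans (cong (λ z → f (A ℕ.+ a) * (T z - T (A ℕ.+ a))) (ℕ.+-identityʳ (A ℕ.+ a)))
                     (trans (cong (f (A ℕ.+ a) *_) (+-inverseʳ (T (A ℕ.+ a)))) (*-zeroʳ (f (A ℕ.+ a)))))))
    go (suc K) A = begin
        sumℤ (d ℕ.+ K ℕ.* d) (λ i → G (A ℕ.+ i))                      ≡⟨ sum-split d (K ℕ.* d) _ ⟩
        S + sumℤ (K ℕ.* d) (λ i → G (A ℕ.+ (d ℕ.+ i)))                ≡⟨ cong (_+_ S) (sum-ext (K ℕ.* d) (λ i → cong G (sym (ℕ.+-assoc A d i)))) ⟩
        S + sumℤ (K ℕ.* d) (λ i → G (A ℕ.+ d ℕ.+ i))                  ≈⟨ +-cong-≈ (≈-refl {S}) (go K (A ℕ.+ d)) ⟩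
        S + Φ (A ℕ.+ d) K                                             ≡⟨ sym (sum-distrib-+ d _ _) ⟩
        sumℤ d (λ a → G (A ℕ.+ a) + f (A ℕ.+ d ℕ.+ a) * (T (A ℕ.+ d ℕ.+ a ℕ.+ K ℕ.* d) - T (A ℕ.+ d ℕ.+ a)))
                                                                      ≈⟨ sum-cong-≈ d (λ a _ → step a) ⟩
        Φ A (suc K)                                                   ∎
      where
      open ≈-Reasoning
      S = sumℤ d (λ i → G (A ℕ.+ i))
      step : ∀ a → G (A ℕ.+ a) + f (A ℕ.+ d ℕ.+ a) * (T (A ℕ.+ d ℕ.+ a ℕ.+ K ℕ.* d) - T (A ℕ.+ d ℕ.+ a))
                   ≈ f (A ℕ.+ a) * (T (A ℕ.+ a ℕ.+ suc K ℕ.* d) - T (A ℕ.+ a))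
      step a = begin
          f j * h j + f (A ℕ.+ d ℕ.+ a) * (T (A ℕ.+ d ℕ.+ a ℕ.+ K ℕ.* d) - T (A ℕ.+ d ℕ.+ a))
            ≡⟨ cong₂ (λ u v → f j * h j + u * (T v - T (A ℕ.+ d ℕ.+ a))) (trans (cong f (shift A a)) (f-periodic j)) (shift-end A a K) ⟩
          f j * h j + f j * (T w - T (A ℕ.+ d ℕ.+ a))     ≡⟨ cong (λ u → f j * h j + f j * (T w - T u)) (shift A a) ⟩
          f j * h j + f j * (T w - T (j ℕ.+ d))           ≈⟨ +-cong-≈ (*-cong-≈ (≈-refl {f j}) h≈ΔT) (≈-refl {f j * (T w - T (j ℕ.+ d))}) ⟩
          f j * (T (j ℕ.+ d) - T j) + f j * (T w - T (j ℕ.+ d)) ≡⟨ telescope (f j) (T (j ℕ.+ d)) (T j) (T w) ⟩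
          f j * (T w - T j)                               ∎
        where
        j = A ℕ.+ a
        w = A ℕ.+ a ℕ.+ suc K ℕ.* d
        h≈ΔT : h j ≈ T (j ℕ.+ d) - T j
        h≈ΔT = ≈-sym (≈-trans (+-cong-≈ (T-step j) (≈-refl { - T j})) (≡⇒≈ (cancel (T j) (h j))))


module Fermat (p : ℕ) (p-prime : Prime p) where

  open import Data.Nat as ℕ using (zero; suc; _≤_; _∸_; z≤n; s≤s)
  import Data.Nat.Properties as ℕ
  open import Data.Nat.Base using (nonTrivial⇒n>1)
  open import Data.Nat.Divisibility using (_∣_; ∣⇒≤; m∣m*n)
  open import Data.Nat.Primality using (euclidsLemma; prime⇒nonTrivial)
  open import Data.Nat.Combinatorics using (_C_; nCn≡1)
  open import Data.Integer hiding (suc; pred; _≤_; _<_; _≥_; _>_; _≤?_; _<?_)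
  open import Data.Integer.Properties
  open import Relation.Binary.PropositionalEquality using (_≡_; cong; sym; trans; subst)
  open import Data.Integer.Tactic.RingSolver using (solve-∀)
  open import Data.Sum using (inj₁; inj₂)
  open import Relation.Nullary using (¬_)
  open import Data.Empty using (⊥-elim)
  open Sums
  open BinomialCoefficients
  open BinomialTheorem
  open IntegerPowers
  open Congruence p

  p≡2+[p∸2] : p ≡ suc (suc (p ∸ 2))
  p≡2+[p∸2] = sym (ℕ.m+[n∸m]≡n (nonTrivial⇒n>1 p {{prime⇒nonTrivial p-prime}}))

  0<j<p⇒p∤j : ∀ j → 0 ℕ.< j → j ℕ.< p → ¬ (p ∣ j)
  0<j<p⇒p∤j (suc j) _ j<p p∣j = ℕ.<⇒≱ j<p (∣⇒≤ p∣j)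

  p∣pC[1+k] : ∀ k → suc k ℕ.< p → p ∣ (p C suc k)
  p∣pC[1+k] k 1+k<p with euclidsLemma (suc k) (p C suc k) p-prime (subst (p ∣_) (sym absorption) (m∣m*n (suc (p ∸ 2) C k)))
    where
    absorption : suc k ℕ.* (p C suc k) ≡ p ℕ.* (suc (p ∸ 2) C k)
    absorption = subst (λ z → suc k ℕ.* (z C suc k) ≡ z ℕ.* (suc (p ∸ 2) C k)) (sym p≡2+[p∸2])
                       ([1+k]*[1+n]C[1+k]≡[1+n]*nCk (suc (p ∸ 2)) k)
  ... | inj₁ p∣1+k = ⊥-elim (0<j<p⇒p∤j (suc k) (s≤s z≤n) 1+k<p p∣1+k)
  ... | inj₂ p∣pC1+k = p∣pC1+k

  frobenius : ∀ x → (x + 1ℤ) ^ p ≈ x ^ p + 1ℤ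
  frobenius x = begin
      (x + 1ℤ) ^ p                  ≡⟨ cong ((x + 1ℤ) ^_) p≡2+[p∸2] ⟩
      (x + 1ℤ) ^ suc p-1            ≡⟨ binomial-theorem x (suc p-1) ⟩
      1ℤ + sumℤ (suc p-1) term      ≡⟨ cong (_+_ 1ℤ) (sum-snoc p-1 term) ⟩
      1ℤ + (sumℤ p-1 term + term p-1) ≈⟨ +-cong-≈ (≈-refl {1ℤ}) (+-cong-≈ (sum-≈0 p-1 middle≈0) (≈-refl {term p-1})) ⟩
      1ℤ + (0ℤ + term p-1)           ≡⟨ cong (λ t → 1ℤ + (0ℤ + t)) last-term ⟩
      1ℤ + (0ℤ + x ^ p)             ≡⟨ rearrange (x ^ p) ⟩
      x ^ p + 1ℤ                    ∎
    where
    open ≈-Reasoning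
    p-1 = suc (p ∸ 2)
    term : ℕ → ℤ
    term j = binomialℤ (suc p-1) (suc j) * x ^ suc j
    rearrange : ∀ y → 1ℤ + (0ℤ + y) ≡ y + 1ℤ
    rearrange = solve-∀
    last-term : term p-1 ≡ x ^ p
    last-term = trans (cong (λ z → + z * x ^ suc p-1) (nCn≡1 (suc p-1)))
                      (trans (*-identityˡ _) (cong (x ^_) (sym p≡2+[p∸2])))
    middle≈0 : ∀ i → i ℕ.< p-1 → term i ≈ 0ℤ
    middle≈0 i i<p-1 = ≈-trans (*-cong-≈ (∣⇒≈0 {binomialℤ (suc p-1) (suc i)} p∣C) (≈-refl {x ^ suc i})) (≡⇒≈ (*-zeroˡ (x ^ suc i)))
      where
      p∣C : p ∣ (suc p-1 C suc i)
      p∣C = subst (λ z → p ∣ (z C suc i)) p≡2+[p∸2] (p∣pC[1+k] i (subst (suc (suc i) ≤_) (sym p≡2+[p∸2]) (s≤s i<p-1)))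

  fermat : ∀ a → (+ a) ^ p ≈ + a
  fermat zero    = ≡⇒≈ (cong (0ℤ ^_) p≡2+[p∸2])
  fermat (suc a) = begin
      (+ suc a) ^ p   ≡⟨ cong (_^ p) 1+a≡a+1 ⟩
      (+ a + 1ℤ) ^ p  ≈⟨ frobenius (+ a) ⟩
      (+ a) ^ p + 1ℤ  ≈⟨ +-cong-≈ (fermat a) (≈-refl {1ℤ}) ⟩
      + a + 1ℤ        ≡⟨ sym 1+a≡a+1 ⟩
      + suc a         ∎
    where
    open ≈-Reasoning
    1+a≡a+1 : + suc a ≡ + a + 1ℤ
    1+a≡a+1 = trans (cong +_ (ℕ.+-comm 1 a)) (pos-+ a 1)

  fermat-little : ∀ a → ¬ (p ∣ a) → (+ a) ^ suc (p ∸ 2) ≈ 1ℤ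
  fermat-little a p∤a = x-y≈0⇒x≈y (euclid-≈0 p-prime {+ a} {y - 1ℤ} a[y-1]≈0 p∤a)
    where
    y = (+ a) ^ suc (p ∸ 2)
    expand : ∀ a y → a * (y - 1ℤ) ≡ a * y - a
    expand = solve-∀
    a[y-1]≈0 : + a * (y - 1ℤ) ≈ 0ℤ
    a[y-1]≈0 = ≈-trans (≡⇒≈ (expand (+ a) y)) (x≈y⇒x-y≈0 (≈-trans (≡⇒≈ (cong ((+ a) ^_) (sym p≡2+[p∸2]))) (fermat a)))

  inv : ℕ → ℤ
  inv a = (+ a) ^ (p ∸ 2)

  *-inverseʳ : ∀ a → ¬ (p ∣ a) → + a * inv a ≈ 1ℤ
  *-inverseʳ = fermat-little

  *-inverseˡ : ∀ a → ¬ (p ∣ a) → inv a * + a ≈ 1ℤ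
  *-inverseˡ a p∤a = ≈-trans (≡⇒≈ (*-comm (inv a) (+ a))) (*-inverseʳ a p∤a)

  *-cancelˡ-≈-unit : ∀ j {a b} → 0 ℕ.< j → j ℕ.< p → + j * a ≈ + j * b → a ≈ b
  *-cancelˡ-≈-unit j 0<j j<p = *-cancelˡ-≈ {+ j} {inv j} (*-inverseˡ j (0<j<p⇒p∤j j 0<j j<p))

  x≈-x⇒x≈0 : 2 ℕ.< p → ∀ {a} → a ≈ - a → a ≈ 0ℤ
  x≈-x⇒x≈0 2<p {a} a≈-a = *-cancelˡ-≈-unit 2 (s≤s z≤n) 2<p (begin
      + 2 * a   ≡⟨ double a ⟩
      a - - a   ≈⟨ +-cong-≈ (≈-refl {a}) (neg-cong-≈ (≈-sym a≈-a)) ⟩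
      a - a     ≡⟨ +-inverseʳ a ⟩
      0ℤ        ≡⟨ sym (*-zeroʳ (+ 2)) ⟩
      + 2 * 0ℤ  ∎)
    where
    open ≈-Reasoning
    double : ∀ b → + 2 * b ≡ b - - b
    double = solve-∀

  ^n*^k≈1 : ∀ a n k → ¬ (p ∣ a) → n ℕ.+ k ≡ suc (p ∸ 2) → (+ a) ^ n * (+ a) ^ k ≈ 1ℤ
  ^n*^k≈1 a n k p∤a n+k≡p-1 =
    ≈-trans (≡⇒≈ (trans (sym (^-distribˡ-+-* (+ a) n k)) (cong ((+ a) ^_) n+k≡p-1))) (fermat-little a p∤a)

  inv^n≈^k : ∀ a n k → ¬ (p ∣ a) → n ℕ.+ k ≡ suc (p ∸ 2) → inv a ^ n ≈ (+ a) ^ k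
  inv^n≈^k a n k p∤a n+k≡p-1 = *-cancelˡ-≈ {(+ a) ^ n} {inv a ^ n} inv^n*a^n≈1 (begin
      (+ a) ^ n * inv a ^ n  ≡⟨ sym (^-distribʳ-* (+ a) (inv a) n) ⟩
      (+ a * inv a) ^ n      ≈⟨ ^-cong-≈ n (*-inverseʳ a p∤a) ⟩
      1ℤ ^ n                 ≡⟨ ^-zeroˡ n ⟩
      1ℤ                     ≈⟨ ≈-sym (^n*^k≈1 a n k p∤a n+k≡p-1) ⟩
      (+ a) ^ n * (+ a) ^ k  ∎)
    where
    open ≈-Reasoning
    inv^n*a^n≈1 : inv a ^ n * (+ a) ^ n ≈ 1ℤ
    inv^n*a^n≈1 = ≈-trans (≡⇒≈ (sym (^-distribʳ-* (inv a) (+ a) n))) (≈-trans (^-cong-≈ n (*-inverseˡ a p∤a)) (≡⇒≈ (^-zeroˡ n)))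

  inv-complement : ∀ a b → 0 ℕ.< a → 0 ℕ.< b → a ℕ.+ b ≡ p → inv a ≈ - inv b
  inv-complement a b 0<a 0<b a+b≡p = ≈-sym (*-cancelˡ-≈ {+ a} {inv a} (*-inverseˡ a p∤a) (begin
      + a * - inv b     ≈⟨ *-cong-≈ a≈-b (≈-refl { - inv b}) ⟩
      - + b * - inv b   ≡⟨ neg*neg (+ b) (inv b) ⟩
      + b * inv b       ≈⟨ *-inverseʳ b p∤b ⟩
      1ℤ                ≈⟨ ≈-sym (*-inverseʳ a p∤a) ⟩
      + a * inv a       ∎))
    where
    open ≈-Reasoning
    p∤a : ¬ (p ∣ a)
    p∤a = 0<j<p⇒p∤j a 0<a (subst (a ℕ.<_) a+b≡p (ℕ.m<m+n a 0<b))
    p∤b : ¬ (p ∣ b)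
    p∤b = 0<j<p⇒p∤j b 0<b (subst (b ℕ.<_) (trans (ℕ.+-comm b a) a+b≡p) (ℕ.m<m+n b 0<a))
    a≈-b : + a ≈ - + b
    a≈-b = x-y≈0⇒x≈y (≈-trans (≡⇒≈ (trans (cong (_+_ (+ a)) (neg-involutive (+ b))) (trans (sym (pos-+ a b)) (cong +_ a+b≡p)))) p≈0)
    neg*neg : ∀ a b → - a * - b ≡ a * b
    neg*neg = solve-∀


module BernoulliModP (p : ℕ) (p-prime : Prime p) (2<p : 2 < p) where

  open import Data.Nat as ℕ using (zero; suc; _≤_; _∸_; z≤n; s≤s)
  import Data.Nat.Properties as ℕ
  open import Data.Nat.Combinatorics using (_C_; nCn≡1)
  open import Data.Integer hiding (suc; pred; _≤_; _<_; _≥_; _>_; _≤?_; _<?_)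
  open import Data.Integer.Properties
  open import Relation.Binary.PropositionalEquality using (_≡_; refl; cong; cong₂; sym; trans; module ≡-Reasoning)
  open import Data.Integer.Tactic.RingSolver using (solve-∀)
  open import Data.Sum using (inj₁; inj₂)
  open import Relation.Nullary using (yes; no)
  open Sums
  open BinomialCoefficients
  open BinomialTheorem
  open IntegerPowers
  open Congruence p
  open Fermat p p-prime

  -- The recursion of bernoulliPoly, with 1/(m+1) replaced by its inverse mod p.
  bernoulliStep : ℤ → (m : ℕ) → (ℕ → ℤ) → ℤ
  bernoulliStep x m b = x ^ m - inv (suc m) * sumℤ m (λ k → binomialℤ (suc m) k * b k)

  bernoulliTable : ℤ → ℕ → ℕ → ℤ
  bernoulliTable x zero    k = 0ℤ
  bernoulliTable x (suc m) k with k ℕ.≟ m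
  ... | yes _ = bernoulliStep x m (bernoulliTable x m)
  ... | no  _ = bernoulliTable x m k

  bernoulli : ℤ → ℕ → ℤ
  bernoulli x m = bernoulliStep x m (bernoulliTable x m)

  bernoulliTable-lookup : ∀ x m k → k ℕ.< m → bernoulliTable x m k ≡ bernoulli x k
  bernoulliTable-lookup x (suc m) k k<1+m with k ℕ.≟ m
  ... | yes refl = refl
  ... | no  k≢m  = bernoulliTable-lookup x m k (ℕ.≤∧≢⇒< (ℕ.≤-pred k<1+m) k≢m)

  bernoulli-rec : ∀ x m → bernoulli x m ≡ bernoulliStep x m (bernoulli x)
  bernoulli-rec x m = cong (λ s → x ^ m - inv (suc m) * s)
    (sum-cong m (λ k k<m → cong (binomialℤ (suc m) k *_) (bernoulliTable-lookup x m k k<m)))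

  bernoulli-cong : ∀ m {x y} → x ≈ y → bernoulli x m ≈ bernoulli y m
  bernoulli-cong m {x} {y} x≈y = below (suc m) m (ℕ.n<1+n m)
    where
    below : ∀ n k → k ℕ.< n → bernoulli x k ≈ bernoulli y k
    below (suc n) k k<1+n with ℕ.m≤n⇒m<n∨m≡n (ℕ.≤-pred k<1+n)
    ... | inj₁ k<n  = below n k k<n
    ... | inj₂ refl = ≈-trans (≡⇒≈ (bernoulli-rec x k)) (≈-trans
          (+-cong-≈ (^-cong-≈ k x≈y) (neg-cong-≈ (*-cong-≈ (≈-refl {inv (suc k)})
            (sum-cong-≈ k (λ j j<k → *-cong-≈ (≈-refl {binomialℤ (suc k) j}) (below k j j<k))))))
          (≡⇒≈ (sym (bernoulli-rec y k))))

  binomialSum : (ℕ → ℤ) → ℕ → ℤ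
  binomialSum u m = sumℤ (suc m) (λ k → binomialℤ (suc m) k * u k)

  binomialSum-snoc : ∀ u m → binomialSum u m ≡ sumℤ m (λ k → binomialℤ (suc m) k * u k) + + suc m * u m
  binomialSum-snoc u m = trans (sum-snoc m _) (cong (λ z → sumℤ m (λ k → binomialℤ (suc m) k * u k) + + z * u m) ([1+m]Cm≡1+m m))

  binomialSum-bernoulli : ∀ x m → suc m ℕ.< p → binomialSum (bernoulli x) m ≈ + suc m * x ^ m
  binomialSum-bernoulli x m 1+m<p = begin
      binomialSum (bernoulli x) m       ≡⟨ binomialSum-snoc (bernoulli x) m ⟩
      S + M * bernoulli x m             ≡⟨ cong (λ b → S + M * b) (bernoulli-rec x m) ⟩
      S + M * (x ^ m - I * S)           ≡⟨ expand S M (x ^ m) I ⟩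
      M * x ^ m + S * (1ℤ - M * I)      ≈⟨ +-cong-≈ (≈-refl {M * x ^ m}) (*-cong-≈ (≈-refl {S}) (x≈y⇒x-y≈0 (≈-sym M*I≈1))) ⟩
      M * x ^ m + S * 0ℤ                ≡⟨ trans (cong (_+_ (M * x ^ m)) (*-zeroʳ S)) (+-identityʳ _) ⟩
      M * x ^ m                         ∎
    where
    open ≈-Reasoning
    S = sumℤ m (λ k → binomialℤ (suc m) k * bernoulli x k)
    M = + suc m
    I = inv (suc m)
    M*I≈1 : M * I ≈ 1ℤ
    M*I≈1 = *-inverseʳ (suc m) (0<j<p⇒p∤j (suc m) (s≤s z≤n) 1+m<p)
    expand : ∀ S M X I → S + M * (X - I * S) ≡ M * X + S * (1ℤ - M * I)
    expand = solve-∀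

  -- The binomial sums determine a sequence as long as the leading coefficients m+1 are units.
  binomialSum-injective : ∀ M → suc M ℕ.< p → (u v r : ℕ → ℤ) →
    (∀ m → m ≤ M → binomialSum u m ≈ r m) → (∀ m → m ≤ M → binomialSum v m ≈ r m) → ∀ k → k ≤ M → u k ≈ v k
  binomialSum-injective M 1+M<p u v r u≈r v≈r = agree M ℕ.≤-refl
    where
    agree : ∀ m → m ≤ M → ∀ k → k ≤ m → u k ≈ v k
    below : ∀ m → m ≤ M → ∀ k → k ℕ.< m → u k ≈ v k

    agree m m≤M k k≤m with ℕ.m≤n⇒m<n∨m≡n k≤m
    ... | inj₁ k<m  = below m m≤M k k<m
    ... | inj₂ refl = *-cancelˡ-≈-unit (suc k) (s≤s z≤n) (ℕ.≤-<-trans (s≤s m≤M) 1+M<p)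
      (+-cancelˡ-≈ (≈-trans (≡⇒≈ (sym (binomialSum-snoc u k))) (≈-trans (u≈r k m≤M) (≈-sym (≈-trans (≡⇒≈ (sym (binomialSum-snoc v k))) (v≈r k m≤M)))))
                   (sum-cong-≈ k (λ j j<k → *-cong-≈ (≈-refl {binomialℤ (suc k) j}) (below k m≤M j j<k))))

    below (suc m) 1+m≤M k k<1+m = agree m (ℕ.<⇒≤ 1+m≤M) k (ℕ.≤-pred k<1+m)

  derivative : ℤ → ℕ → ℤ
  derivative x k = + k * x ^ (k ∸ 1)

  binomialSum-derivative : ∀ x m → binomialSum (derivative x) m ≡ + suc m * sumℤ m (λ j → binomialℤ m j * x ^ j)
  binomialSum-derivative x m = begin
      binomialℤ (suc m) 0 * (0ℤ * x ^ 0) + sumℤ m (λ j → binomialℤ (suc m) (suc j) * derivative x (suc j))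
        ≡⟨ cong₂ _+_ (trans (cong (binomialℤ (suc m) 0 *_) (*-zeroˡ (x ^ 0))) (*-zeroʳ (binomialℤ (suc m) 0))) (sum-ext m absorb) ⟩
      0ℤ + sumℤ m (λ j → + suc m * (binomialℤ m j * x ^ j))   ≡⟨ +-identityˡ _ ⟩
      sumℤ m (λ j → + suc m * (binomialℤ m j * x ^ j))        ≡⟨ *-distribˡ-sum m (+ suc m) _ ⟩
      + suc m * sumℤ m (λ j → binomialℤ m j * x ^ j)          ∎
    where
    open ≡-Reasoning
    swap : ∀ a b c → a * (b * c) ≡ (b * a) * c
    swap = solve-∀
    absorb : ∀ j → binomialℤ (suc m) (suc j) * derivative x (suc j) ≡ + suc m * (binomialℤ m j * x ^ j)
    absorb j = begin
      binomialℤ (suc m) (suc j) * (+ suc j * x ^ j)  ≡⟨ swap (binomialℤ (suc m) (suc j)) (+ suc j) (x ^ j) ⟩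
      (+ suc j * binomialℤ (suc m) (suc j)) * x ^ j  ≡⟨ cong (_* x ^ j) (sym (pos-* (suc j) (suc m C suc j))) ⟩
      + (suc j ℕ.* (suc m C suc j)) * x ^ j          ≡⟨ cong (λ z → + z * x ^ j) ([1+k]*[1+n]C[1+k]≡[1+n]*nCk m j) ⟩
      + (suc m ℕ.* (m C j)) * x ^ j                  ≡⟨ cong (_* x ^ j) (pos-* (suc m) (m C j)) ⟩
      (+ suc m * binomialℤ m j) * x ^ j              ≡⟨ *-assoc (+ suc m) (binomialℤ m j) (x ^ j) ⟩
      + suc m * (binomialℤ m j * x ^ j)              ∎

  -- Both sides have the binomial sums (m+1)(x+1)^m.
  bernoulli-difference : ∀ x k → suc k ℕ.< p → bernoulli (x + 1ℤ) k ≈ bernoulli x k + derivative x k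
  bernoulli-difference x k 1+k<p =
    binomialSum-injective k 1+k<p (bernoulli (x + 1ℤ)) (λ j → bernoulli x j + derivative x j) (λ m → + suc m * (x + 1ℤ) ^ m)
      (λ m m≤k → binomialSum-bernoulli (x + 1ℤ) m (bound m≤k)) shifted k ℕ.≤-refl
    where
    bound : ∀ {m} → m ≤ k → suc m ℕ.< p
    bound m≤k = ℕ.≤-<-trans (s≤s m≤k) 1+k<p
    shifted : ∀ m → m ≤ k → binomialSum (λ j → bernoulli x j + derivative x j) m ≈ + suc m * (x + 1ℤ) ^ m
    shifted m m≤k = begin
        binomialSum (λ j → bernoulli x j + derivative x j) m
          ≡⟨ sum-ext (suc m) (λ j → *-distribˡ-+ (binomialℤ (suc m) j) (bernoulli x j) (derivative x j)) ⟩
        sumℤ (suc m) (λ j → binomialℤ (suc m) j * bernoulli x j + binomialℤ (suc m) j * derivative x j)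
          ≡⟨ sum-distrib-+ (suc m) (λ j → binomialℤ (suc m) j * bernoulli x j) (λ j → binomialℤ (suc m) j * derivative x j) ⟩
        binomialSum (bernoulli x) m + binomialSum (derivative x) m
          ≈⟨ +-cong-≈ (binomialSum-bernoulli x m (bound m≤k)) (≡⇒≈ (binomialSum-derivative x m)) ⟩
        + suc m * x ^ m + + suc m * T ≡⟨ sym (*-distribˡ-+ (+ suc m) (x ^ m) T) ⟩
        + suc m * (x ^ m + T)         ≡⟨ cong (+ suc m *_) x^m+T≡[x+1]^m ⟩
        + suc m * (x + 1ℤ) ^ m        ∎
      where
      open ≈-Reasoning
      T = sumℤ m (λ j → binomialℤ m j * x ^ j)
      x^m+T≡[x+1]^m : x ^ m + T ≡ (x + 1ℤ) ^ m
      x^m+T≡[x+1]^m = sym (trans (binomial-theorem x m) (trans (sum-snoc m _)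
        (trans (cong (_+_ T) (trans (cong (λ z → + z * x ^ m) (nCn≡1 m)) (*-identityˡ (x ^ m)))) (+-comm T (x ^ m)))))

  bernoulliNumber : ℕ → ℤ
  bernoulliNumber = bernoulli 0ℤ

  -- B_m(1), expanded binomially.
  binomialTransform : ℕ → ℤ
  binomialTransform m = sumℤ (suc m) (λ j → binomialℤ m j * bernoulliNumber j)

  binomialSum-alternating : ∀ m →
    binomialSum (λ k → [-1]^ k * binomialTransform k) m ≡ [-1]^ m * binomialSum bernoulliNumber m
  binomialSum-alternating m = begin
      binomialSum (λ k → [-1]^ k * binomialTransform k) m
        ≡⟨ sum-ext (suc m) expand ⟩
      sumℤ (suc m) (λ k → sumℤ (suc k) (a k))
        ≡⟨ sum-triangle-swap (suc m) a ⟩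
      sumℤ (suc m) (λ j → sumℤ (suc m ∸ j) (λ l → a (j ℕ.+ l) j))
        ≡⟨ sum-cong (suc m) column ⟩
      sumℤ (suc m) (λ j → [-1]^ m * (binomialℤ (suc m) j * bernoulliNumber j))
        ≡⟨ *-distribˡ-sum (suc m) ([-1]^ m) (λ j → binomialℤ (suc m) j * bernoulliNumber j) ⟩
      [-1]^ m * binomialSum bernoulliNumber m ∎
    where
    open ≡-Reasoning
    a : ℕ → ℕ → ℤ
    a k j = bernoulliNumber j * (binomialℤ (suc m) k * binomialℤ k j * [-1]^ k)
    expand : ∀ k → binomialℤ (suc m) k * ([-1]^ k * binomialTransform k) ≡ sumℤ (suc k) (a k)
    expand k = trans (sym (*-assoc (binomialℤ (suc m) k) ([-1]^ k) (binomialTransform k)))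
      (trans (sym (*-distribˡ-sum (suc k) (binomialℤ (suc m) k * [-1]^ k) (λ j → binomialℤ k j * bernoulliNumber j)))
             (sum-ext (suc k) (λ j → reorder (binomialℤ (suc m) k) ([-1]^ k) (binomialℤ k j) (bernoulliNumber j))))
      where
      reorder : ∀ C s c b → (C * s) * (c * b) ≡ b * (C * c * s)
      reorder = solve-∀
    column : ∀ j → j ℕ.< suc m → sumℤ (suc m ∸ j) (λ l → a (j ℕ.+ l) j) ≡ [-1]^ m * (binomialℤ (suc m) j * bernoulliNumber j)
    column j j<1+m = trans (*-distribˡ-sum (suc m ∸ j) (bernoulliNumber j) _)
      (trans (cong (bernoulliNumber j *_) (alternating-subset-sum m j (ℕ.≤-pred j<1+m)))
             (reorder (bernoulliNumber j) ([-1]^ m) (binomialℤ (suc m) j)))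
      where
      reorder : ∀ b s c → b * (s * c) ≡ s * (c * b)
      reorder = solve-∀

  -- Both sides have the binomial sums (m+1) 0^m.
  bernoulliNumber-reflection : ∀ k → suc k ℕ.< p → [-1]^ k * binomialTransform k ≈ bernoulliNumber k
  bernoulliNumber-reflection k 1+k<p =
    binomialSum-injective k 1+k<p (λ j → [-1]^ j * binomialTransform j) bernoulliNumber (λ m → + suc m * 0ℤ ^ m)
      (λ m m≤k → ≈-trans (≡⇒≈ (binomialSum-alternating m))
                   (≈-trans (*-cong-≈ (≈-refl {[-1]^ m}) (binomialSum-bernoulli 0ℤ m (bound m≤k))) (≡⇒≈ (sign-absorbed m))))
      (λ m m≤k → binomialSum-bernoulli 0ℤ m (bound m≤k)) k ℕ.≤-refl
    where
    bound : ∀ {m} → m ≤ k → suc m ℕ.< p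
    bound m≤k = ℕ.≤-<-trans (s≤s m≤k) 1+k<p
    sign-absorbed : ∀ m → [-1]^ m * (+ suc m * 0ℤ ^ m) ≡ + suc m * 0ℤ ^ m
    sign-absorbed zero    = refl
    sign-absorbed (suc m) = trans (cong ([-1]^ (suc m) *_) (*-zeroʳ (+ suc (suc m))))
                                  (trans (*-zeroʳ ([-1]^ (suc m))) (sym (*-zeroʳ (+ suc (suc m)))))

  binomialTransform≈bernoulliNumber : ∀ m → suc (suc m) ℕ.< p → binomialTransform (suc (suc m)) ≈ bernoulliNumber (suc (suc m))
  binomialTransform≈bernoulliNumber m 2+m<p = begin
      binomialTransform m+2                                           ≡⟨ sum-snoc m+2 (λ j → binomialℤ m+2 j * bernoulliNumber j) ⟩
      binomialSum bernoulliNumber (suc m) + binomialℤ m+2 m+2 * bernoulliNumber m+2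
        ≈⟨ +-cong-≈ (binomialSum-bernoulli 0ℤ (suc m) 2+m<p) (≡⇒≈ (trans (cong (λ z → + z * bernoulliNumber m+2) (nCn≡1 m+2)) (*-identityˡ _))) ⟩
      + m+2 * 0ℤ ^ suc m + bernoulliNumber m+2                        ≡⟨ trans (cong (_+ bernoulliNumber m+2) (*-zeroʳ (+ m+2))) (+-identityˡ _) ⟩
      bernoulliNumber m+2                                             ∎
    where
    open ≈-Reasoning
    m+2 = suc (suc m)

  bernoulliNumber-odd : ∀ k → suc (suc (suc k)) ℕ.< p → [-1]^ (suc (suc k)) ≡ -1ℤ → bernoulliNumber (suc (suc k)) ≈ 0ℤ
  bernoulliNumber-odd k 3+k<p odd = x≈-x⇒x≈0 2<p (begin
      bernoulliNumber m                ≈⟨ ≈-sym (bernoulliNumber-reflection m 3+k<p) ⟩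
      [-1]^ m * binomialTransform m    ≡⟨ cong (_* binomialTransform m) odd ⟩
      -1ℤ * binomialTransform m        ≡⟨ -1*i≡-i (binomialTransform m) ⟩
      - binomialTransform m            ≈⟨ neg-cong-≈ (binomialTransform≈bernoulliNumber k (ℕ.<-trans (ℕ.n<1+n _) 3+k<p)) ⟩
      - bernoulliNumber m              ∎)
    where
    open ≈-Reasoning
    m = suc (suc k)

  half : ℤ
  half = inv 2

  2*half≈1 : + 2 * half ≈ 1ℤ
  2*half≈1 = *-inverseʳ 2 (0<j<p⇒p∤j 2 (s≤s z≤n) 2<p)

  module OddIndex (k : ℕ) (3+k<p : suc (suc (suc k)) ℕ.< p) (odd : [-1]^ (suc (suc k)) ≡ -1ℤ) where

    m-1 = suc k
    m = suc m-1

    B : ℤ → ℤ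
    B x = bernoulli x m

    B-difference : ∀ x → B (x + 1ℤ) ≈ B x + + m * x ^ m-1
    B-difference x = bernoulli-difference x m 3+k<p

    B[0]≈0 : B 0ℤ ≈ 0ℤ
    B[0]≈0 = bernoulliNumber-odd k 3+k<p odd

    B[1]≈0 : B 1ℤ ≈ 0ℤ
    B[1]≈0 = ≈-trans (B-difference 0ℤ) (+-cong-≈ B[0]≈0 (≡⇒≈ (*-zeroʳ (+ m))))

    B-reflection : ∀ x → B (1ℤ - x) ≈ - B x
    B-reflection x = x+y≈0⇒x≈-y (≈-trans (shift-invariant⇒constant G G-shift x) (+-cong-≈ B[1]≈0 B[0]≈0))
      where
      G : ℤ → ℤ
      G x = B (1ℤ - x) + B x
      even-power : ∀ x → + m * (- x) ^ m-1 ≡ + m * x ^ m-1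
      even-power x = cong (+ m *_) (trans (neg-^ x m-1) (trans (cong (_* x ^ m-1) [-1]^m-1≡1) (*-identityˡ _)))
        where
        [-1]^m-1≡1 : [-1]^ m-1 ≡ 1ℤ
        [-1]^m-1≡1 = trans (negate-twice ([-1]^ m-1)) (cong -_ odd)
          where
          negate-twice : ∀ a → a ≡ - (-1ℤ * a)
          negate-twice = solve-∀
      1-[x+1]≡-x : ∀ x → 1ℤ - (x + 1ℤ) ≡ - x
      1-[x+1]≡-x = solve-∀
      1-x≡-x+1 : ∀ x → 1ℤ - x ≡ - x + 1ℤ
      1-x≡-x+1 = solve-∀
      swap : ∀ a b d → a + (b + d) ≡ (a + d) + b
      swap = solve-∀
      G-shift : ∀ x → G (x + 1ℤ) ≈ G x
      G-shift x = begin
          B (1ℤ - (x + 1ℤ)) + B (x + 1ℤ)           ≡⟨ cong (λ z → B z + B (x + 1ℤ)) (1-[x+1]≡-x x) ⟩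
          B (- x) + B (x + 1ℤ)                     ≈⟨ +-cong-≈ (≈-refl {B (- x)}) (B-difference x) ⟩
          B (- x) + (B x + + m * x ^ m-1)          ≡⟨ swap (B (- x)) (B x) (+ m * x ^ m-1) ⟩
          (B (- x) + + m * x ^ m-1) + B x          ≡⟨ cong (λ z → (B (- x) + z) + B x) (sym (even-power x)) ⟩
          (B (- x) + + m * (- x) ^ m-1) + B x      ≈⟨ +-cong-≈ (≈-sym (B-difference (- x))) (≈-refl {B x}) ⟩
          B (- x + 1ℤ) + B x                       ≡⟨ cong (λ z → B z + B x) (sym (1-x≡-x+1 x)) ⟩
          G x                                      ∎
        where open ≈-Reasoning

    B[half]≈0 : B half ≈ 0ℤ
    B[half]≈0 = x≈-x⇒x≈0 2<p (≈-trans (≈-sym (bernoulli-cong m 1-half≈half)) (B-reflection half))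
      where
      1-half≈half : 1ℤ - half ≈ half
      1-half≈half = ≈-trans (+-cong-≈ (≈-sym 2*half≈1) (≈-refl { - half})) (≡⇒≈ (cancel half))
        where
        cancel : ∀ a → + 2 * a - a ≡ a
        cancel = solve-∀

    B-duplication : ∀ x → (+ 2) ^ m-1 * (B (x * half) + B (x * half + half)) ≈ B x
    B-duplication x = ≈-sym (x-y≈0⇒x≈y (≈-trans (shift-invariant⇒constant H H-shift x) H[0]≈0))
      where
      t = (+ 2) ^ m-1
      H : ℤ → ℤ
      H x = B x - t * (B (x * half) + B (x * half + half))
      H[0]≈0 : H 0ℤ ≈ 0ℤ
      H[0]≈0 = ≈-trans (+-cong-≈ B[0]≈0 (neg-cong-≈ (*-cong-≈ (≈-refl {t}) (+-cong-≈ B[0]≈0 (≈-trans (≡⇒≈ (cong B (+-identityˡ half))) B[half]≈0)))))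
                       (≡⇒≈ (cong (λ z → 0ℤ - z) (*-zeroʳ t)))
      step-half : ∀ x → (x + 1ℤ) * half ≡ x * half + half
      step-half x = distrib x half
        where
        distrib : ∀ x a → (x + 1ℤ) * a ≡ x * a + a
        distrib = solve-∀
      step-one : ∀ x → (x + 1ℤ) * half + half ≈ x * half + 1ℤ
      step-one x = ≈-trans (≡⇒≈ (distrib x half)) (+-cong-≈ (≈-refl {x * half}) 2*half≈1)
        where
        distrib : ∀ x a → (x + 1ℤ) * a + a ≡ x * a + + 2 * a
        distrib = solve-∀
      rescale : ∀ x → t * (x * half) ^ m-1 ≈ x ^ m-1
      rescale x = ≈-trans (≡⇒≈ (sym (^-distribʳ-* (+ 2) (x * half) m-1)))
        (^-cong-≈ m-1 (≈-trans (≡⇒≈ (reorder x half)) (≈-trans (*-cong-≈ 2*half≈1 (≈-refl {x})) (≡⇒≈ (*-identityˡ x)))))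
        where
        reorder : ∀ x a → + 2 * (x * a) ≡ + 2 * a * x
        reorder = solve-∀
      regroup : ∀ b d X t b₂ b₁ Y → (b + d * X) - t * (b₂ + (b₁ + d * Y)) ≡ (b - t * (b₁ + b₂)) + d * (X - t * Y)
      regroup = solve-∀
      H-shift : ∀ x → H (x + 1ℤ) ≈ H x
      H-shift x = begin
          B (x + 1ℤ) - t * (B ((x + 1ℤ) * half) + B ((x + 1ℤ) * half + half))
            ≈⟨ +-cong-≈ (B-difference x) (neg-cong-≈ (*-cong-≈ (≈-refl {t})
                 (+-cong-≈ (≡⇒≈ (cong B (step-half x))) (≈-trans (bernoulli-cong m (step-one x)) (B-difference y))))) ⟩
          (B x + + m * x ^ m-1) - t * (B (y + half) + (B y + + m * y ^ m-1))
            ≡⟨ regroup (B x) (+ m) (x ^ m-1) t (B (y + half)) (B y) (y ^ m-1) ⟩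
          H x + + m * (x ^ m-1 - t * y ^ m-1)
            ≈⟨ +-cong-≈ (≈-refl {H x}) (*-cong-≈ (≈-refl {+ m}) (x≈y⇒x-y≈0 (≈-sym (rescale x)))) ⟩
          H x + + m * 0ℤ ≡⟨ trans (cong (_+_ (H x)) (*-zeroʳ (+ m))) (+-identityʳ (H x)) ⟩
          H x ∎
        where
        open ≈-Reasoning
        y = x * half


module SignedLegendre where

  open import Data.Nat as ℕ using (zero; suc; z≤n; s≤s; _%_; _/_)
  import Data.Nat.Properties as ℕ
  open import Data.Nat.DivMod using (m≡m%n+[m/n]*n; m%n<n; [m+kn]%n≡m%n; %-distribˡ-+)
  open import Data.Nat.Divisibility using (_∣_; divides)
  open import Data.Nat.Primality using (Prime; prime⇒irreducible)
  open import Data.Nat.Tactic.RingSolver using (solve-∀)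
  open import Data.Integer as ℤ using (ℤ; +_; -[1+_]; -1ℤ)
  import Data.Integer.Properties as ℤ
  open import Data.Sum using (_⊎_; inj₁; inj₂)
  open import Data.Empty using (⊥-elim)
  open import Relation.Nullary using (¬_)
  open import Relation.Binary.PropositionalEquality using (_≡_; refl; cong; cong₂; sym; trans)
  open import Defs using (legendre3; negOnePow)

  signedLegendre : ℕ → ℤ
  signedLegendre j = negOnePow j ℤ.* legendre3 (+ j)

  residueLegendre3 : ℕ → ℤ
  residueLegendre3 0 = + 0
  residueLegendre3 1 = + 1
  residueLegendre3 _ = -[1+ 0 ]

  legendre3≡residueLegendre3 : ∀ a → legendre3 a ≡ residueLegendre3 (a ℤ.%ℕ 3)
  legendre3≡residueLegendre3 a with a ℤ.%ℕ 3
  ... | 0           = refl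
  ... | 1           = refl
  ... | suc (suc _) = refl

  signedLegendre-+6 : ∀ j → signedLegendre (j ℕ.+ 6) ≡ signedLegendre j
  signedLegendre-+6 j = cong₂ ℤ._*_ (trans (ℤ.^-distribˡ-+-* -1ℤ j 6) (ℤ.*-identityʳ (-1ℤ ℤ.^ j)))
    (trans (legendre3≡residueLegendre3 (+ (j ℕ.+ 6)))
      (trans (cong residueLegendre3 ([m+kn]%n≡m%n j 2 3)) (sym (legendre3≡residueLegendre3 (+ j)))))

  signedLegendre-periodic : ∀ q r → signedLegendre (q ℕ.* 6 ℕ.+ r) ≡ signedLegendre r
  signedLegendre-periodic zero    r = refl
  signedLegendre-periodic (suc q) r =
    trans (cong signedLegendre (trans (ℕ.+-assoc 6 (q ℕ.* 6) r) (ℕ.+-comm 6 _)))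
          (trans (signedLegendre-+6 (q ℕ.* 6 ℕ.+ r)) (signedLegendre-periodic q r))

  signedLegendre-%6 : ∀ j → signedLegendre j ≡ signedLegendre (j % 6)
  signedLegendre-%6 j = trans (cong signedLegendre (trans (m≡m%n+[m/n]*n j 6) (ℕ.+-comm (j % 6) _)))
                              (signedLegendre-periodic (j / 6) (j % 6))

  -- signedLegendre takes the values 0, -1, -1, 0, 1, 1 on 0, …, 5.
  signedLegendre-reflect<6 : ∀ r s → r ℕ.< 6 → s ℕ.< 6 → (r ℕ.+ s) % 6 ≡ 3 → signedLegendre r ≡ signedLegendre s
  signedLegendre-reflect<6 0 0 _ _ ()
  signedLegendre-reflect<6 0 1 _ _ ()
  signedLegendre-reflect<6 0 2 _ _ ()
  signedLegendre-reflect<6 0 3 _ _ _ = refl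
  signedLegendre-reflect<6 0 4 _ _ ()
  signedLegendre-reflect<6 0 5 _ _ ()
  signedLegendre-reflect<6 1 0 _ _ ()
  signedLegendre-reflect<6 1 1 _ _ ()
  signedLegendre-reflect<6 1 2 _ _ _ = refl
  signedLegendre-reflect<6 1 3 _ _ ()
  signedLegendre-reflect<6 1 4 _ _ ()
  signedLegendre-reflect<6 1 5 _ _ ()
  signedLegendre-reflect<6 2 0 _ _ ()
  signedLegendre-reflect<6 2 1 _ _ _ = refl
  signedLegendre-reflect<6 2 2 _ _ ()
  signedLegendre-reflect<6 2 3 _ _ ()
  signedLegendre-reflect<6 2 4 _ _ ()
  signedLegendre-reflect<6 2 5 _ _ ()
  signedLegendre-reflect<6 3 0 _ _ _ = refl
  signedLegendre-reflect<6 3 1 _ _ ()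
  signedLegendre-reflect<6 3 2 _ _ ()
  signedLegendre-reflect<6 3 3 _ _ ()
  signedLegendre-reflect<6 3 4 _ _ ()
  signedLegendre-reflect<6 3 5 _ _ ()
  signedLegendre-reflect<6 4 0 _ _ ()
  signedLegendre-reflect<6 4 1 _ _ ()
  signedLegendre-reflect<6 4 2 _ _ ()
  signedLegendre-reflect<6 4 3 _ _ ()
  signedLegendre-reflect<6 4 4 _ _ ()
  signedLegendre-reflect<6 4 5 _ _ _ = refl
  signedLegendre-reflect<6 5 0 _ _ ()
  signedLegendre-reflect<6 5 1 _ _ ()
  signedLegendre-reflect<6 5 2 _ _ ()
  signedLegendre-reflect<6 5 3 _ _ ()
  signedLegendre-reflect<6 5 4 _ _ _ = refl
  signedLegendre-reflect<6 5 5 _ _ ()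
  signedLegendre-reflect<6 (suc (suc (suc (suc (suc (suc _)))))) _ (s≤s (s≤s (s≤s (s≤s (s≤s (s≤s ())))))) _ _
  signedLegendre-reflect<6 _ (suc (suc (suc (suc (suc (suc _)))))) _ (s≤s (s≤s (s≤s (s≤s (s≤s (s≤s ())))))) _

  signedLegendre-reflect : ∀ y y' → (y ℕ.+ y') % 6 ≡ 3 → signedLegendre y ≡ signedLegendre y'
  signedLegendre-reflect y y' y+y'≡3 = trans (signedLegendre-%6 y)
    (trans (signedLegendre-reflect<6 (y % 6) (y' % 6) (m%n<n y 6) (m%n<n y' 6) (trans (sym (%-distribˡ-+ y y' 6)) y+y'≡3))
           (sym (signedLegendre-%6 y')))

  1<d<p⇒d∤p : ∀ {p d} → Prime p → 1 ℕ.< d → d ℕ.< p → ¬ (d ∣ p)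
  1<d<p⇒d∤p p-prime 1<d d<p d∣p with prime⇒irreducible p-prime d∣p
  ... | inj₁ refl = ℕ.<-irrefl refl 1<d
  ... | inj₂ refl = ℕ.<-irrefl refl d<p

  prime>3⇒p%6≡1⊎p%6≡5 : ∀ p → Prime p → 3 ℕ.< p → p % 6 ≡ 1 ⊎ p % 6 ≡ 5
  prime>3⇒p%6≡1⊎p%6≡5 p p-prime 3<p with p % 6 | m%n<n p 6 | m≡m%n+[m/n]*n p 6
  ... | 0 | _ | p≡ = ⊥-elim (1<d<p⇒d∤p p-prime (s≤s (s≤s z≤n)) (ℕ.<-trans (ℕ.n<1+n 2) 3<p) (divides (p / 6 ℕ.* 3) (trans p≡ (factor (p / 6)))))
    where
    factor : ∀ q → 0 ℕ.+ q ℕ.* 6 ≡ q ℕ.* 3 ℕ.* 2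
    factor = solve-∀
  ... | 1 | _ | _  = inj₁ refl
  ... | 2 | _ | p≡ = ⊥-elim (1<d<p⇒d∤p p-prime (s≤s (s≤s z≤n)) (ℕ.<-trans (ℕ.n<1+n 2) 3<p) (divides (1 ℕ.+ p / 6 ℕ.* 3) (trans p≡ (factor (p / 6)))))
    where
    factor : ∀ q → 2 ℕ.+ q ℕ.* 6 ≡ (1 ℕ.+ q ℕ.* 3) ℕ.* 2
    factor = solve-∀
  ... | 3 | _ | p≡ = ⊥-elim (1<d<p⇒d∤p p-prime (s≤s (s≤s z≤n)) 3<p (divides (1 ℕ.+ p / 6 ℕ.* 2) (trans p≡ (factor (p / 6)))))
    where
    factor : ∀ q → 3 ℕ.+ q ℕ.* 6 ≡ (1 ℕ.+ q ℕ.* 2) ℕ.* 3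
    factor = solve-∀
  ... | 4 | _ | p≡ = ⊥-elim (1<d<p⇒d∤p p-prime (s≤s (s≤s z≤n)) (ℕ.<-trans (ℕ.n<1+n 2) 3<p) (divides (2 ℕ.+ p / 6 ℕ.* 3) (trans p≡ (factor (p / 6)))))
    where
    factor : ∀ q → 4 ℕ.+ q ℕ.* 6 ≡ (2 ℕ.+ q ℕ.* 3) ℕ.* 2
    factor = solve-∀
  ... | 5 | _ | _  = inj₂ refl
  ... | suc (suc (suc (suc (suc (suc _))))) | s≤s (s≤s (s≤s (s≤s (s≤s (s≤s ()))))) | _


module AlternatingSum (p : ℕ) (p-prime : Prime p) (3<p : 3 < p) where

  open import Data.Nat as ℕ using (suc; _≤_; _∸_; z≤n; s≤s; _%_; _/_)
  import Data.Nat.Properties as ℕ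
  open import Data.Nat.DivMod using (m≡m%n+[m/n]*n; [m+kn]%n≡m%n)
  open import Data.Nat.Divisibility using (_∣_; ∣⇒≤)
  open import Data.Nat.Primality using (euclidsLemma)
  open import Data.Integer hiding (suc; pred; _≤_; _<_; _≥_; _>_; _≤?_; _<?_; _/_; _%_)
  open import Data.Integer.Properties
  open import Relation.Binary.PropositionalEquality using (_≡_; cong; cong₂; sym; trans; subst; module ≡-Reasoning)
  open import Data.Integer.Tactic.RingSolver using (solve-∀)
  open import Data.Nat.Tactic.RingSolver using () renaming (solve-∀ to ℕ-solve-∀)
  open import Data.Sum using (inj₁; inj₂)
  open import Relation.Nullary using (¬_)
  open Sums
  open IntegerPowers
  open Congruence p
  open Fermat p p-prime
  open SignedLegendre

  2<p : 2 ℕ.< p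
  2<p = ℕ.<-trans (ℕ.n<1+n 2) 3<p

  open BernoulliModP p p-prime 2<p

  1≤p : 1 ≤ p
  1≤p = ℕ.<-trans (s≤s z≤n) 2<p

  i<p-1⇒1+i<p : ∀ {i} → i ℕ.< p ∸ 1 → suc i ℕ.< p
  i<p-1⇒1+i<p i<p-1 = subst (suc _ ℕ.<_) (ℕ.m+[n∸m]≡n 1≤p) (s≤s i<p-1)

  even⇒1+[p∸n]<p : ∀ n .{{_ : ℕ.NonZero n}} → 2 ∣ n → suc (p ∸ n) ℕ.< p
  even⇒1+[p∸n]<p n 2∣n = subst (suc (suc (p ∸ n)) ≤_) (sym p≡2+[p∸2]) (s≤s (s≤s (ℕ.∸-monoʳ-≤ p (∣⇒≤ 2∣n))))

  third sixth : ℤ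
  third = inv 3
  sixth = inv 6

  p∤6 : ¬ (p ∣ 6)
  p∤6 p∣6 with euclidsLemma 2 3 p-prime p∣6
  ... | inj₁ p∣2 = 0<j<p⇒p∤j 2 (s≤s z≤n) 2<p p∣2
  ... | inj₂ p∣3 = 0<j<p⇒p∤j 3 (s≤s z≤n) 3<p p∣3

  6*sixth≈1 : + 6 * sixth ≈ 1ℤ
  6*sixth≈1 = *-inverseʳ 6 p∤6

  3*third≈1 : + 3 * third ≈ 1ℤ
  3*third≈1 = *-inverseʳ 3 (0<j<p⇒p∤j 3 (s≤s z≤n) 3<p)

  *-cancelˡ-≈-6 : ∀ {a b} → + 6 * a ≈ + 6 * b → a ≈ b
  *-cancelˡ-≈-6 = *-cancelˡ-≈ {+ 6} {sixth} (≈-trans (≡⇒≈ (*-comm sixth (+ 6))) 6*sixth≈1)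

  alternatingSum : ℕ → ℤ
  alternatingSum n = sumℤ (p ∸ 1) (λ i → signedLegendre (p ℕ.+ suc i) * inv (suc i) ^ n)

  target : ℕ → ℤ
  target n = - (+ (2 ℕ.^ (n ℕ.+ 1) ℕ.+ 4)) * inv n * sixth ^ n * bernoulli third (p ∸ n)

  -- The even case, with m = p - n written as 2 + k; m is odd since n is even and p is odd.
  module Even (k n : ℕ) (3+k<p : suc (suc (suc k)) ℕ.< p) (odd : [-1]^ (suc (suc k)) ≡ -1ℤ)
              (m+n≡p : suc (suc k) ℕ.+ n ≡ p) (0<n : 0 ℕ.< n) where

    open OddIndex k 3+k<p odd

    m<p : m ℕ.< p
    m<p = ℕ.<-trans (ℕ.n<1+n m) 3+k<p

    n+[m-1]≡p-1 : n ℕ.+ m-1 ≡ suc (p ∸ 2)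
    n+[m-1]≡p-1 = ℕ.suc-injective (trans (cong suc (ℕ.+-comm n m-1)) (trans m+n≡p p≡2+[p∸2]))

    scale : ℤ
    scale = (+ 6) ^ m-1 * inv m

    T : ℕ → ℤ
    T j = scale * B (+ j * sixth)

    T-step : ∀ j → T (j ℕ.+ 6) ≈ T j + (+ j) ^ m-1
    T-step j = begin
        scale * B (+ (j ℕ.+ 6) * sixth)              ≈⟨ *-cong-≈ (≈-refl {scale}) (bernoulli-cong m [j+6]/6≈j/6+1) ⟩
        scale * B (y + 1ℤ)                           ≈⟨ *-cong-≈ (≈-refl {scale}) (B-difference y) ⟩
        scale * (B y + + m * y ^ m-1)                ≡⟨ regroup ((+ 6) ^ m-1) (inv m) (B y) (+ m) (y ^ m-1) ⟩
        T j + ((+ 6) ^ m-1 * y ^ m-1) * (inv m * + m) ≈⟨ +-cong-≈ (≈-refl {T j}) (*-cong-≈ (≈-refl {(+ 6) ^ m-1 * y ^ m-1}) inv-m*m≈1) ⟩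
        T j + ((+ 6) ^ m-1 * y ^ m-1) * 1ℤ           ≡⟨ cong (_+_ (T j)) (trans (*-identityʳ _) (sym (^-distribʳ-* (+ 6) y m-1))) ⟩
        T j + (+ 6 * y) ^ m-1                        ≈⟨ +-cong-≈ (≈-refl {T j}) (^-cong-≈ m-1 6*[j/6]≈j) ⟩
        T j + (+ j) ^ m-1                            ∎
      where
      open ≈-Reasoning
      y = + j * sixth
      inv-m*m≈1 : inv m * + m ≈ 1ℤ
      inv-m*m≈1 = *-inverseˡ m (0<j<p⇒p∤j m (s≤s z≤n) m<p)
      [j+6]/6≈j/6+1 : + (j ℕ.+ 6) * sixth ≈ y + 1ℤ
      [j+6]/6≈j/6+1 = ≈-trans (≡⇒≈ (trans (cong (_* sixth) (pos-+ j 6)) (*-distribʳ-+ sixth (+ j) (+ 6)))) (+-cong-≈ (≈-refl {y}) 6*sixth≈1)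
      6*[j/6]≈j : + 6 * y ≈ + j
      6*[j/6]≈j = ≈-trans (≡⇒≈ (reorder (+ 6) (+ j) sixth)) (≈-trans (*-cong-≈ 6*sixth≈1 (≈-refl {+ j})) (≡⇒≈ (*-identityˡ (+ j))))
        where
        reorder : ∀ a b c → a * (b * c) ≡ (a * c) * b
        reorder = solve-∀
      regroup : ∀ A I B M Y → (A * I) * (B + M * Y) ≡ (A * I) * B + (A * Y) * (I * M)
      regroup = solve-∀

    T-p+ : ∀ x → T (p ℕ.+ x) ≈ T x
    T-p+ x = *-cong-≈ (≈-refl {scale}) (bernoulli-cong m (*-cong-≈ (p+c≈c x) (≈-refl {sixth})))

    B[sixth]≡B[1/6] : B (+ 1 * sixth) ≡ B sixth
    B[sixth]≡B[1/6] = cong B (*-identityˡ sixth)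

    B[2/6]≈B[third] : B (+ 2 * sixth) ≈ B third
    B[2/6]≈B[third] = bernoulli-cong m (*-cancelˡ-≈-unit 3 (s≤s z≤n) 3<p
      (≈-trans (≡⇒≈ (reorder sixth)) (≈-trans 6*sixth≈1 (≈-sym 3*third≈1))))
      where
      reorder : ∀ a → + 3 * (+ 2 * a) ≡ + 6 * a
      reorder = solve-∀

    B[4/6]≈-B[third] : B (+ 4 * sixth) ≈ - B third
    B[4/6]≈-B[third] = ≈-trans (bernoulli-cong m (*-cancelˡ-≈-6 4/6≈1-third)) (B-reflection third)
      where
      reorder : ∀ a → + 6 * (+ 4 * a) ≡ + 4 * (+ 6 * a)
      reorder = solve-∀
      expand : ∀ a → + 6 * (1ℤ - a) ≡ + 6 - + 2 * (+ 3 * a)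
      expand = solve-∀
      4/6≈1-third : + 6 * (+ 4 * sixth) ≈ + 6 * (1ℤ - third)
      4/6≈1-third = ≈-trans (≡⇒≈ (reorder sixth)) (≈-trans (*-cong-≈ (≈-refl {+ 4}) 6*sixth≈1)
        (≈-sym (≈-trans (≡⇒≈ (expand third)) (+-cong-≈ (≈-refl {+ 6}) (neg-cong-≈ (*-cong-≈ (≈-refl {+ 2}) 3*third≈1))))))

    B[5/6]≈-B[sixth] : B (+ 5 * sixth) ≈ - B sixth
    B[5/6]≈-B[sixth] = ≈-trans (bernoulli-cong m (*-cancelˡ-≈-6 5/6≈1-sixth)) (B-reflection sixth)
      where
      reorder : ∀ a → + 6 * (+ 5 * a) ≡ + 5 * (+ 6 * a)
      reorder = solve-∀
      expand : ∀ a → + 6 * (1ℤ - a) ≡ + 6 - + 6 * a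
      expand = solve-∀
      5/6≈1-sixth : + 6 * (+ 5 * sixth) ≈ + 6 * (1ℤ - sixth)
      5/6≈1-sixth = ≈-trans (≡⇒≈ (reorder sixth)) (≈-trans (*-cong-≈ (≈-refl {+ 5}) 6*sixth≈1)
        (≈-sym (≈-trans (≡⇒≈ (expand sixth)) (+-cong-≈ (≈-refl {+ 6}) (neg-cong-≈ 6*sixth≈1)))))

    B[6/6]≈0 : B (+ 6 * sixth) ≈ 0ℤ
    B[6/6]≈0 = ≈-trans (bernoulli-cong m 6*sixth≈1) B[1]≈0

    closedForm : ℤ
    closedForm = scale * (+ 2 * B sixth + + 2 * B third)

    T-combination : - T 0 + T 1 + T 2 - T 4 - T 5 + T 6 ≈ closedForm
    T-combination = begin
        - T 0 + T 1 + T 2 - T 4 - T 5 + T 6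
          ≡⟨ regroup (T 0) (T 1) (T 2) (T 4) (T 5) (T 6) scale (B sixth) (B third) ⟩
        closedForm + (- (T 0 - scale * 0ℤ) + (T 1 - scale * B sixth) + (T 2 - scale * B third)
                      - (T 4 - scale * (- B third)) - (T 5 - scale * (- B sixth)) + (T 6 - scale * 0ℤ))
          ≈⟨ +-cong-≈ (≈-refl {closedForm}) (+-cong-≈ (+-cong-≈ (+-cong-≈ (+-cong-≈ (+-cong-≈
               (neg-cong-≈ (T≈ 0 B[0]≈0)) (T≈ 1 (≡⇒≈ B[sixth]≡B[1/6]))) (T≈ 2 B[2/6]≈B[third]))
               (neg-cong-≈ (T≈ 4 B[4/6]≈-B[third]))) (neg-cong-≈ (T≈ 5 B[5/6]≈-B[sixth]))) (T≈ 6 B[6/6]≈0)) ⟩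
        closedForm + (- 0ℤ + 0ℤ + 0ℤ - 0ℤ - 0ℤ + 0ℤ) ≡⟨ +-identityʳ closedForm ⟩
        closedForm ∎
      where
      open ≈-Reasoning
      T≈ : ∀ c {w} → B (+ c * sixth) ≈ w → T c - scale * w ≈ 0ℤ
      T≈ c B≈w = x≈y⇒x-y≈0 (*-cong-≈ (≈-refl {scale}) B≈w)
      regroup : ∀ t0 t1 t2 t4 t5 t6 c b6 b3 → - t0 + t1 + t2 - t4 - t5 + t6 ≡
        c * (+ 2 * b6 + + 2 * b3) + (- (t0 - c * 0ℤ) + (t1 - c * b6) + (t2 - c * b3) - (t4 - c * (- b3)) - (t5 - c * (- b6)) + (t6 - c * 0ℤ))
      regroup = solve-∀

    powered : ℕ → ℤ
    powered j = signedLegendre j * (+ j) ^ m-1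

    poweredSum : ℤ
    poweredSum = sumℤ (p ∸ 1) (λ i → powered (p ℕ.+ suc i))

    telescoping : ∀ K A → sumℤ (K ℕ.* 6) (λ i → powered (A ℕ.+ i))
                          ≈ sumℤ 6 (λ a → signedLegendre (A ℕ.+ a) * (T (A ℕ.+ a ℕ.+ K ℕ.* 6) - T (A ℕ.+ a)))
    telescoping = periodic-telescoping 6 signedLegendre (λ j → (+ j) ^ m-1) T signedLegendre-+6 T-step

    poweredSum-p≡1+6q : ∀ q → p ≡ 1 ℕ.+ q ℕ.* 6 → poweredSum ≈ closedForm
    poweredSum-p≡1+6q q p≡1+6q = begin
        poweredSum                                        ≡⟨ cong (λ L → sumℤ L (λ i → powered (p ℕ.+ suc i))) (cong (_∸ 1) p≡1+6q) ⟩
        sumℤ (q ℕ.* 6) (λ i → powered (p ℕ.+ suc i))      ≡⟨ sum-ext (q ℕ.* 6) (λ i → cong powered (shift p i)) ⟩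
        sumℤ (q ℕ.* 6) (λ i → powered (p ℕ.+ 1 ℕ.+ i))    ≈⟨ telescoping q (p ℕ.+ 1) ⟩
        sumℤ 6 (λ a → signedLegendre (p ℕ.+ 1 ℕ.+ a) * (T (p ℕ.+ 1 ℕ.+ a ℕ.+ q ℕ.* 6) - T (p ℕ.+ 1 ℕ.+ a)))
                                                          ≈⟨ sum-cong-≈ 6 (λ a _ → reduce a) ⟩
        sumℤ 6 (λ a → signedLegendre (2 ℕ.+ a) * (T a - T (1 ℕ.+ a)))
                                                          ≡⟨ expand (T 0) (T 1) (T 2) (T 3) (T 4) (T 5) (T 6) ⟩
        - T 0 + T 1 + T 2 - T 4 - T 5 + T 6               ≈⟨ T-combination ⟩
        closedForm                                        ∎
      where
      open ≈-Reasoning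
      shift : ∀ p i → p ℕ.+ suc i ≡ p ℕ.+ 1 ℕ.+ i
      shift = ℕ-solve-∀
      weight : ∀ q a → 1 ℕ.+ q ℕ.* 6 ℕ.+ 1 ℕ.+ a ≡ q ℕ.* 6 ℕ.+ (2 ℕ.+ a)
      weight = ℕ-solve-∀
      shift-end : ∀ p q a → p ℕ.+ 1 ℕ.+ a ℕ.+ q ℕ.* 6 ≡ p ℕ.+ ((1 ℕ.+ q ℕ.* 6) ℕ.+ a)
      shift-end = ℕ-solve-∀
      shift-start : ∀ p a → p ℕ.+ 1 ℕ.+ a ≡ p ℕ.+ (1 ℕ.+ a)
      shift-start = ℕ-solve-∀
      expand : ∀ t0 t1 t2 t3 t4 t5 t6 → -1ℤ * (t0 - t1) + (0ℤ * (t1 - t2) + (1ℤ * (t2 - t3) + (1ℤ * (t3 - t4)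
        + (0ℤ * (t4 - t5) + (-1ℤ * (t5 - t6) + 0ℤ))))) ≡ - t0 + t1 + t2 - t4 - t5 + t6
      expand = solve-∀
      reduce : ∀ a → signedLegendre (p ℕ.+ 1 ℕ.+ a) * (T (p ℕ.+ 1 ℕ.+ a ℕ.+ q ℕ.* 6) - T (p ℕ.+ 1 ℕ.+ a))
                     ≈ signedLegendre (2 ℕ.+ a) * (T a - T (1 ℕ.+ a))
      reduce a = *-cong-≈
        (≡⇒≈ (trans (cong (λ z → signedLegendre (z ℕ.+ 1 ℕ.+ a)) p≡1+6q) (trans (cong signedLegendre (weight q a)) (signedLegendre-periodic q (2 ℕ.+ a)))))
        (+-cong-≈ (≈-trans (≡⇒≈ (cong T (trans (shift-end p q a) (cong (λ z → p ℕ.+ (z ℕ.+ a)) (sym p≡1+6q))))) (≈-trans (T-p+ (p ℕ.+ a)) (T-p+ a)))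
                  (neg-cong-≈ (≈-trans (≡⇒≈ (cong T (shift-start p a))) (T-p+ (1 ℕ.+ a)))))

    poweredSum-p≡5+6q : ∀ q → p ≡ 5 ℕ.+ q ℕ.* 6 → poweredSum ≈ closedForm
    poweredSum-p≡5+6q q p≡5+6q = begin
        poweredSum                                        ≈⟨ ≈-sym widen ⟩
        sumℤ (suc q ℕ.* 6) (λ i → powered (p ℕ.+ i))      ≈⟨ telescoping (suc q) p ⟩
        sumℤ 6 (λ a → signedLegendre (p ℕ.+ a) * (T (p ℕ.+ a ℕ.+ suc q ℕ.* 6) - T (p ℕ.+ a)))
                                                          ≈⟨ sum-cong-≈ 6 (λ a _ → reduce a) ⟩
        sumℤ 6 (λ a → signedLegendre (5 ℕ.+ a) * (T (1 ℕ.+ a) - T a))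
                                                          ≡⟨ expand (T 0) (T 1) (T 2) (T 3) (T 4) (T 5) (T 6) ⟩
        - T 0 + T 1 + T 2 - T 4 - T 5 + T 6               ≈⟨ T-combination ⟩
        closedForm                                        ∎
      where
      open ≈-Reasoning
      G : ℕ → ℤ
      G i = powered (p ℕ.+ i)
      powered≈0 : ∀ j → + j ≈ 0ℤ → powered j ≈ 0ℤ
      powered≈0 j j≈0 = ≈-trans (*-cong-≈ (≈-refl {signedLegendre j}) (^-cong-≈ m-1 j≈0)) (≡⇒≈ (*-zeroʳ (signedLegendre j)))
      length : suc q ℕ.* 6 ≡ 1 ℕ.+ ((p ∸ 1) ℕ.+ 1)
      length = trans (rearrange q) (trans (cong (ℕ._+ 1) (sym p≡5+6q))
                 (trans (cong (ℕ._+ 1) (sym (ℕ.m+[n∸m]≡n 1≤p))) (ℕ.+-assoc 1 (p ∸ 1) 1)))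
        where
        rearrange : ∀ q → suc q ℕ.* 6 ≡ 5 ℕ.+ q ℕ.* 6 ℕ.+ 1
        rearrange = ℕ-solve-∀
      -- The two extra terms, at p and 2p, vanish mod p.
      widen : sumℤ (suc q ℕ.* 6) G ≈ poweredSum
      widen = begin
          sumℤ (suc q ℕ.* 6) G                                         ≡⟨ cong (λ L → sumℤ L G) length ⟩
          sumℤ (1 ℕ.+ ((p ∸ 1) ℕ.+ 1)) G                               ≡⟨ sum-split 1 ((p ∸ 1) ℕ.+ 1) G ⟩
          sumℤ 1 G + sumℤ ((p ∸ 1) ℕ.+ 1) (λ i → G (suc i))            ≡⟨ cong (_+_ (sumℤ 1 G)) (sum-split (p ∸ 1) 1 (λ i → G (suc i))) ⟩
          sumℤ 1 G + (poweredSum + sumℤ 1 (λ i → G (suc (p ∸ 1 ℕ.+ i))))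
            ≈⟨ +-cong-≈ (+-cong-≈ (powered≈0 (p ℕ.+ 0) (p+c≈c 0)) (≈-refl {0ℤ}))
                        (+-cong-≈ (≈-refl {poweredSum}) (+-cong-≈ (powered≈0 _ 2p≈0) (≈-refl {0ℤ}))) ⟩
          0ℤ + 0ℤ + (poweredSum + (0ℤ + 0ℤ))                           ≡⟨ trans (+-identityˡ _) (+-identityʳ poweredSum) ⟩
          poweredSum                                                   ∎
        where
        2p≈0 : + (p ℕ.+ suc (p ∸ 1 ℕ.+ 0)) ≈ 0ℤ
        2p≈0 = ≈-trans (p+c≈c _) (≈-trans (≡⇒≈ (cong +_ (trans (cong suc (ℕ.+-identityʳ (p ∸ 1))) (ℕ.m+[n∸m]≡n 1≤p)))) p≈0)
      weight : ∀ q a → 5 ℕ.+ q ℕ.* 6 ℕ.+ a ≡ q ℕ.* 6 ℕ.+ (5 ℕ.+ a)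
      weight = ℕ-solve-∀
      shift-end : ∀ p q a → p ℕ.+ a ℕ.+ suc q ℕ.* 6 ≡ p ℕ.+ ((5 ℕ.+ q ℕ.* 6) ℕ.+ (1 ℕ.+ a))
      shift-end = ℕ-solve-∀
      expand : ∀ t0 t1 t2 t3 t4 t5 t6 → 1ℤ * (t1 - t0) + (0ℤ * (t2 - t1) + (-1ℤ * (t3 - t2) + (-1ℤ * (t4 - t3)
        + (0ℤ * (t5 - t4) + (1ℤ * (t6 - t5) + 0ℤ))))) ≡ - t0 + t1 + t2 - t4 - t5 + t6
      expand = solve-∀
      reduce : ∀ a → signedLegendre (p ℕ.+ a) * (T (p ℕ.+ a ℕ.+ suc q ℕ.* 6) - T (p ℕ.+ a))
                     ≈ signedLegendre (5 ℕ.+ a) * (T (1 ℕ.+ a) - T a)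
      reduce a = *-cong-≈
        (≡⇒≈ (trans (cong (λ z → signedLegendre (z ℕ.+ a)) p≡5+6q) (trans (cong signedLegendre (weight q a)) (signedLegendre-periodic q (5 ℕ.+ a)))))
        (+-cong-≈ (≈-trans (≡⇒≈ (cong T (trans (shift-end p q a) (cong (λ z → p ℕ.+ (z ℕ.+ (1 ℕ.+ a))) (sym p≡5+6q))))) (≈-trans (T-p+ (p ℕ.+ (1 ℕ.+ a))) (T-p+ (1 ℕ.+ a))))
                  (neg-cong-≈ (T-p+ a)))

    poweredSum≈closedForm : poweredSum ≈ closedForm
    poweredSum≈closedForm with prime>3⇒p%6≡1⊎p%6≡5 p p-prime 3<p | m≡m%n+[m/n]*n p 6
    ... | inj₁ p%6≡1 | p≡ = poweredSum-p≡1+6q (p / 6) (trans p≡ (cong (ℕ._+ (p / 6) ℕ.* 6) p%6≡1))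
    ... | inj₂ p%6≡5 | p≡ = poweredSum-p≡5+6q (p / 6) (trans p≡ (cong (ℕ._+ (p / 6) ℕ.* 6) p%6≡5))

    -- 1/i^n ≡ i^(m-1) by Fermat, and i ≡ p + i.
    alternatingSum≈poweredSum : alternatingSum n ≈ poweredSum
    alternatingSum≈poweredSum = sum-cong-≈ (p ∸ 1) (λ i i<p-1 → *-cong-≈ (≈-refl {signedLegendre (p ℕ.+ suc i)})
      (≈-trans (inv^n≈^k (suc i) n m-1 (0<j<p⇒p∤j (suc i) (s≤s z≤n) (i<p-1⇒1+i<p i<p-1)) n+[m-1]≡p-1) (^-cong-≈ m-1 (≈-sym (p+c≈c (suc i))))))

    2^[m-1]*2^n≈1 : (+ 2) ^ m-1 * (+ 2) ^ n ≈ 1ℤ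
    2^[m-1]*2^n≈1 = ≈-trans (≡⇒≈ (*-comm ((+ 2) ^ m-1) ((+ 2) ^ n)))
                            (^n*^k≈1 2 n m-1 (0<j<p⇒p∤j 2 (s≤s z≤n) 2<p) n+[m-1]≡p-1)

    -- The duplication formula at x = 1/3 relates B(1/6) and B(2/3) = -B(1/3) to B(1/3).
    B[sixth]≈[2^n+1]B[third] : B sixth ≈ ((+ 2) ^ n + 1ℤ) * B third
    B[sixth]≈[2^n+1]B[third] = *-cancelˡ-≈ {t} {(+ 2) ^ n} (≈-trans (≡⇒≈ (*-comm ((+ 2) ^ n) t)) 2^[m-1]*2^n≈1) (begin
        t * B sixth                        ≡⟨ split t (B sixth) (B third) ⟩
        t * (B sixth - B third) + t * B third ≈⟨ +-cong-≈ duplication (≈-refl {t * B third}) ⟩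
        B third + t * B third              ≈⟨ +-cong-≈ (≈-sym (≈-trans (*-cong-≈ (≈-trans (≡⇒≈ (*-comm ((+ 2) ^ n) t)) 2^[m-1]*2^n≈1) (≈-refl {B third}))
                                                                (≡⇒≈ (*-identityˡ (B third))))) (≈-refl {t * B third}) ⟩
        ((+ 2) ^ n * t) * B third + t * B third ≡⟨ collect t ((+ 2) ^ n) (B third) ⟩
        t * (((+ 2) ^ n + 1ℤ) * B third)   ∎)
      where
      open ≈-Reasoning
      t = (+ 2) ^ m-1
      third*half≈sixth : third * half ≈ sixth
      third*half≈sixth = *-cancelˡ-≈-6 (≈-trans (≡⇒≈ (reorder third half)) (≈-trans (*-cong-≈ 3*third≈1 2*half≈1) (≈-sym 6*sixth≈1)))
        where
        reorder : ∀ a b → + 6 * (a * b) ≡ (+ 3 * a) * (+ 2 * b)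
        reorder = solve-∀
      third*half+half≈1-third : third * half + half ≈ 1ℤ - third
      third*half+half≈1-third = *-cancelˡ-≈-6 (≈-trans (≡⇒≈ (expand₁ third half))
        (≈-trans (+-cong-≈ (*-cong-≈ 3*third≈1 2*half≈1) (*-cong-≈ (≈-refl {+ 3}) 2*half≈1))
                 (≈-sym (≈-trans (≡⇒≈ (expand₂ third)) (+-cong-≈ (≈-refl {+ 6}) (neg-cong-≈ (*-cong-≈ (≈-refl {+ 2}) 3*third≈1)))))))
        where
        expand₁ : ∀ a b → + 6 * (a * b + b) ≡ (+ 3 * a) * (+ 2 * b) + + 3 * (+ 2 * b)
        expand₁ = solve-∀
        expand₂ : ∀ a → + 6 * (1ℤ - a) ≡ + 6 - + 2 * (+ 3 * a)
        expand₂ = solve-∀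
      duplication : t * (B sixth - B third) ≈ B third
      duplication = ≈-trans (*-cong-≈ (≈-refl {t}) (+-cong-≈ (≈-sym (bernoulli-cong m third*half≈sixth))
                              (≈-sym (≈-trans (bernoulli-cong m third*half+half≈1-third) (B-reflection third)))))
                            (B-duplication third)
      split : ∀ t a b → t * a ≡ t * (a - b) + t * b
      split = solve-∀
      collect : ∀ t u b → (u * t) * b + t * b ≡ t * ((u + 1ℤ) * b)
      collect = solve-∀

    closedForm≈target : closedForm ≈ target n
    closedForm≈target = begin
        scale * (+ 2 * B sixth + + 2 * B third)
          ≈⟨ *-cong-≈ (*-cong-≈ 6^[m-1]≈sixth^n inv-m≈-inv-n) (+-cong-≈ (*-cong-≈ (≈-refl {+ 2}) B[sixth]≈[2^n+1]B[third]) (≈-refl {+ 2 * B third})) ⟩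
        sixth ^ n * - inv n * (+ 2 * (((+ 2) ^ n + 1ℤ) * B third) + + 2 * B third)
          ≡⟨ collect (sixth ^ n) (inv n) ((+ 2) ^ n) (B third) ⟩
        - (+ 2 * (+ 2) ^ n + + 4) * inv n * sixth ^ n * B third
          ≡⟨ cong₂ (λ a b → - a * inv n * sixth ^ n * bernoulli third b) (sym 2^[n+1]+4) (sym p∸n≡m) ⟩
        target n ∎
      where
      open ≈-Reasoning
      6^[m-1]≈sixth^n : (+ 6) ^ m-1 ≈ sixth ^ n
      6^[m-1]≈sixth^n = ≈-sym (inv^n≈^k 6 n m-1 p∤6 n+[m-1]≡p-1)
      inv-m≈-inv-n : inv m ≈ - inv n
      inv-m≈-inv-n = inv-complement m n (s≤s z≤n) 0<n m+n≡p
      collect : ∀ a b c d → a * - b * (+ 2 * ((c + 1ℤ) * d) + + 2 * d) ≡ - (+ 2 * c + + 4) * b * a * d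
      collect = solve-∀
      2^[n+1]+4 : + (2 ℕ.^ (n ℕ.+ 1) ℕ.+ 4) ≡ + 2 * (+ 2) ^ n + + 4
      2^[n+1]+4 = trans (pos-+ (2 ℕ.^ (n ℕ.+ 1)) 4) (cong (_+ + 4) (trans (pos-^ 2 (n ℕ.+ 1)) (cong ((+ 2) ^_) (ℕ.+-comm n 1))))
      p∸n≡m : p ∸ n ≡ m
      p∸n≡m = trans (cong (_∸ n) (sym m+n≡p)) (ℕ.m+n∸n≡m m n)

    alternatingSum≈target : alternatingSum n ≈ target n
    alternatingSum≈target = ≈-trans alternatingSum≈poweredSum (≈-trans poweredSum≈closedForm closedForm≈target)

  alternatingSum-even : ∀ n .{{_ : ℕ.NonZero n}} → 2 ∣ n → n ℕ.+ 1 ℕ.< p → alternatingSum n ≈ target n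
  alternatingSum-even n 2∣n n+1<p = Even.alternatingSum≈target k n 3+k<p odd m+n≡p 0<n
    where
    0<n = ℕ.>-nonZero⁻¹ n
    n≤p : n ≤ p
    n≤p = ℕ.<⇒≤ (ℕ.≤-<-trans (ℕ.m≤m+n n 1) n+1<p)
    2≤m : 2 ≤ p ∸ n
    2≤m = ℕ.m+n≤o⇒m≤o∸n 2 (subst (ℕ._≤ p) (trans (sym (ℕ.+-suc n 1)) (ℕ.+-comm n 2)) n+1<p)
    k = p ∸ n ∸ 2
    m+n≡p : suc (suc k) ℕ.+ n ≡ p
    m+n≡p = trans (cong (ℕ._+ n) (ℕ.m+[n∸m]≡n 2≤m)) (ℕ.m∸n+n≡m n≤p)
    3+k<p : suc (suc (suc k)) ℕ.< p
    3+k<p = subst (λ z → suc z ℕ.< p) (sym (ℕ.m+[n∸m]≡n 2≤m)) (even⇒1+[p∸n]<p n 2∣n)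
    odd : [-1]^ (suc (suc k)) ≡ -1ℤ
    odd = begin
      [-1]^ (suc (suc k))                 ≡⟨ sym (*-identityʳ _) ⟩
      [-1]^ (suc (suc k)) * 1ℤ            ≡⟨ cong ([-1]^ (suc (suc k)) *_) (sym ([-1]^-even 2∣n)) ⟩
      [-1]^ (suc (suc k)) * [-1]^ n       ≡⟨ sym ([-1]^-+ (suc (suc k)) n) ⟩
      [-1]^ (suc (suc k) ℕ.+ n)           ≡⟨ cong [-1]^ m+n≡p ⟩
      [-1]^ p                             ≡⟨ [-1]^-odd p (1<d<p⇒d∤p p-prime (s≤s (s≤s z≤n)) 2<p) ⟩
      -1ℤ                                 ∎
      where open ≡-Reasoning

  3p%6≡3 : (p ℕ.+ p ℕ.+ p) % 6 ≡ 3
  3p%6≡3 with prime>3⇒p%6≡1⊎p%6≡5 p p-prime 3<p | m≡m%n+[m/n]*n p 6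
  ... | inj₁ p%6≡1 | p≡ = trans (cong (λ z → (z ℕ.+ z ℕ.+ z) % 6) (trans p≡ (cong (ℕ._+ (p / 6) ℕ.* 6) p%6≡1)))
                                (trans (cong (_% 6) (triple (p / 6))) ([m+kn]%n≡m%n 3 (p / 6 ℕ.* 3) 6))
    where
    triple : ∀ q → 1 ℕ.+ q ℕ.* 6 ℕ.+ (1 ℕ.+ q ℕ.* 6) ℕ.+ (1 ℕ.+ q ℕ.* 6) ≡ 3 ℕ.+ q ℕ.* 3 ℕ.* 6
    triple = ℕ-solve-∀
  ... | inj₂ p%6≡5 | p≡ = trans (cong (λ z → (z ℕ.+ z ℕ.+ z) % 6) (trans p≡ (cong (ℕ._+ (p / 6) ℕ.* 6) p%6≡5)))
                                (trans (cong (_% 6) (triple (p / 6))) ([m+kn]%n≡m%n 3 (2 ℕ.+ p / 6 ℕ.* 3) 6))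
    where
    triple : ∀ q → 5 ℕ.+ q ℕ.* 6 ℕ.+ (5 ℕ.+ q ℕ.* 6) ℕ.+ (5 ℕ.+ q ℕ.* 6) ≡ 3 ℕ.+ (2 ℕ.+ q ℕ.* 3) ℕ.* 6
    triple = ℕ-solve-∀

  -- For odd n the substitution i ↦ p - i negates every term.
  alternatingSum-odd : ∀ n → ¬ (2 ∣ n) → alternatingSum n ≈ 0ℤ
  alternatingSum-odd n 2∤n = x≈-x⇒x≈0 2<p (begin
      alternatingSum n                         ≡⟨ sum-reverse (p ∸ 1) F ⟩
      sumℤ (p ∸ 1) (λ i → F (p ∸ 1 ∸ suc i))   ≈⟨ sum-cong-≈ (p ∸ 1) reflect ⟩
      sumℤ (p ∸ 1) (λ i → - F i)               ≡⟨ neg-distrib-sum (p ∸ 1) F ⟩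
      - alternatingSum n                       ∎)
    where
    open ≈-Reasoning
    F : ℕ → ℤ
    F i = signedLegendre (p ℕ.+ suc i) * inv (suc i) ^ n
    reflect : ∀ i → i ℕ.< p ∸ 1 → F (p ∸ 1 ∸ suc i) ≈ - F i
    reflect i i<p-1 = begin
        signedLegendre (p ℕ.+ suc j) * inv (suc j) ^ n   ≡⟨ cong (_* inv (suc j) ^ n) (signedLegendre-reflect (p ℕ.+ suc j) (p ℕ.+ suc i) 3p+[j+i]%6≡3) ⟩
        χ * inv (suc j) ^ n                              ≈⟨ *-cong-≈ (≈-refl {χ}) (^-cong-≈ n (inv-complement (suc j) (suc i) (s≤s z≤n) (s≤s z≤n) 1+j+1+i≡p)) ⟩
        χ * (- inv (suc i)) ^ n                          ≡⟨ cong (χ *_) (trans (neg-^ (inv (suc i)) n) (trans (cong (_* inv (suc i) ^ n) ([-1]^-odd n 2∤n)) (-1*i≡-i _))) ⟩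
        χ * - (inv (suc i) ^ n)                          ≡⟨ sym (neg-distribʳ-* χ _) ⟩
        - F i                                            ∎
      where
      j = p ∸ 1 ∸ suc i
      χ = signedLegendre (p ℕ.+ suc i)
      1+j+1+i≡p : suc j ℕ.+ suc i ≡ p
      1+j+1+i≡p = trans (cong suc (ℕ.m∸n+n≡m i<p-1)) (ℕ.m+[n∸m]≡n 1≤p)
      3p+[j+i]%6≡3 : (p ℕ.+ suc j ℕ.+ (p ℕ.+ suc i)) % 6 ≡ 3
      3p+[j+i]%6≡3 = trans (cong (_% 6) (trans (regroup p (suc j) (suc i)) (cong (λ z → p ℕ.+ p ℕ.+ z) 1+j+1+i≡p))) 3p%6≡3
        where
        regroup : ∀ p a b → p ℕ.+ a ℕ.+ (p ℕ.+ b) ≡ p ℕ.+ p ℕ.+ (a ℕ.+ b)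
        regroup = ℕ-solve-∀


module Residues (p : ℕ) (p-prime : Prime p) (2<p : 2 < p) where

  open import Data.Nat as ℕ using (zero; suc; z≤n; s≤s)
  import Data.Nat.Properties as ℕ
  open import Data.Nat.GCD using () renaming (gcd to gcdℕ)
  open import Data.Nat.Combinatorics using (_C_)
  open import Data.Nat.Divisibility using (_∣_; ∣-trans; m∣m*n; n∣m*n)
  open import Data.Nat.Primality using (euclidsLemma)
  open import Data.Integer as ℤ using (ℤ; +_; 0ℤ; 1ℤ; ∣_∣)
  import Data.Integer.Properties as ℤ
  open import Data.Integer.GCD using (gcd)
  open import Data.Rational as ℚ using (ℚ; mkℚ; _/_; ↥_; ↧_; ↧ₙ_; 0ℚ; 1ℚ)
  import Data.Rational.Properties as ℚ
  import Data.Rational.Unnormalised as ℚᵘ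
  import Data.Rational.Unnormalised.Properties as ℚᵘ
  open import Data.Fin as Fin using (Fin; toℕ)
  open import Data.Vec using (Vec; []; _∷_; _∷ʳ_; lookup)
  open import Data.Product using (Σ; _×_; _,_; ∃)
  open import Data.Sum using (_⊎_; inj₁; inj₂)
  open import Relation.Binary.PropositionalEquality using (_≡_; refl; cong; cong₂; sym; trans; subst; subst₂)
  open import Data.Integer.Tactic.RingSolver using (solve-∀)
  open import Relation.Nullary using (¬_)
  open import Defs using (_^ℚ_; sumFin; bernStep; bernList; bernoulliPoly; _≡_[modℚ_])
  open Sums
  open BinomialTheorem using (binomialℤ)
  open Congruence p
  open Fermat p p-prime
  open BernoulliModP p p-prime 2<p

  record HasResidue (q : ℚ) (ρ : ℤ) : Set where
    constructor _,_
    field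
      p∤denominator : ¬ (p ∣ ↧ₙ q)
      numerator≈    : ↥ q ≈ ρ ℤ.* ↧ q

  p∤1 : ¬ (p ∣ 1)
  p∤1 = 0<j<p⇒p∤j 1 (s≤s z≤n) (ℕ.<-trans (ℕ.n<1+n 1) 2<p)

  p∤* : ∀ {a b} → ¬ (p ∣ a) → ¬ (p ∣ b) → ¬ (p ∣ a ℕ.* b)
  p∤* p∤a p∤b p∣ab with euclidsLemma _ _ p-prime p∣ab
  ... | inj₁ p∣a = p∤a p∣a
  ... | inj₂ p∣b = p∤b p∣b

  -- Normalising i / n divides both parts by their gcd, which is prime to p.
  residue-/ : ∀ {ρ} i n .{{_ : ℕ.NonZero n}} → ¬ (p ∣ n) → i ≈ ρ ℤ.* + n → HasResidue (i / n) ρ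
  residue-/ {ρ} i n p∤n i≈ρn = p∤D , x-y≈0⇒x≈y (euclid-≈0 p-prime {g} g*[num-ρden]≈0 p∤G)
    where
    G = gcdℕ ∣ i ∣ n
    g = gcd i (+ n)
    D = ↧ₙ (i / n)
    D*G≡n : D ℕ.* G ≡ n
    D*G≡n = ℤ.+-injective (trans (ℤ.pos-* D G) (ℚ.↧-/ i n))
    p∤D : ¬ (p ∣ D)
    p∤D p∣D = p∤n (subst (p ∣_) D*G≡n (∣-trans p∣D (m∣m*n G)))
    p∤G : ¬ (p ∣ G)
    p∤G p∣G = p∤n (subst (p ∣_) D*G≡n (∣-trans p∣G (n∣m*n D)))
    expand : ∀ a b g r → g ℤ.* (a ℤ.- r ℤ.* b) ≡ a ℤ.* g ℤ.- r ℤ.* (b ℤ.* g)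
    expand = solve-∀
    g*[num-ρden]≈0 : g ℤ.* (↥ (i / n) ℤ.- ρ ℤ.* ↧ (i / n)) ≈ 0ℤ
    g*[num-ρden]≈0 = ≈-trans (≡⇒≈ (trans (expand (↥ (i / n)) (↧ (i / n)) g ρ) (cong₂ (λ a b → a ℤ.- ρ ℤ.* b) (ℚ.↥-/ i n) (ℚ.↧-/ i n))))
                             (x≈y⇒x-y≈0 i≈ρn)

  residue-cong : ∀ {q ρ ρ'} → ρ ≈ ρ' → HasResidue q ρ → HasResidue q ρ'
  residue-cong ρ≈ρ' (p∤den , num≈) = p∤den , ≈-trans num≈ (*-cong-≈ ρ≈ρ' ≈-refl)

  residue-integer : ∀ z → HasResidue (z / 1) z
  residue-integer z = residue-/ z 1 p∤1 (≡⇒≈ (sym (ℤ.*-identityʳ z)))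

  residue-0 : HasResidue 0ℚ 0ℤ
  residue-0 = p∤1 , ≈-refl

  residue-1 : HasResidue 1ℚ 1ℤ
  residue-1 = p∤1 , ≈-refl

  residue-recip : ∀ i .{{_ : ℕ.NonZero i}} → ¬ (p ∣ i) → HasResidue ((+ 1) / i) (inv i)
  residue-recip i p∤i = residue-/ (+ 1) i p∤i (≈-sym (*-inverseˡ i p∤i))

  residue-+ : ∀ {a b α β} → HasResidue a α → HasResidue b β → HasResidue (a ℚ.+ b) (α ℤ.+ β)
  residue-+ {mkℚ _ da _} {mkℚ _ db _} {α} {β} (p∤da , a≈) (p∤db , b≈) =
    residue-/ _ (suc da ℕ.* suc db) (p∤* p∤da p∤db)
      (≈-trans (+-cong-≈ (*-cong-≈ a≈ (≈-refl {+ suc db})) (*-cong-≈ b≈ (≈-refl {+ suc da})))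
               (≡⇒≈ (trans (collect α β (+ suc da) (+ suc db)) (cong ((α ℤ.+ β) ℤ.*_) (sym (ℤ.pos-* (suc da) (suc db)))))))
    where
    collect : ∀ α β A B → α ℤ.* A ℤ.* B ℤ.+ β ℤ.* B ℤ.* A ≡ (α ℤ.+ β) ℤ.* (A ℤ.* B)
    collect = solve-∀

  residue-* : ∀ {a b α β} → HasResidue a α → HasResidue b β → HasResidue (a ℚ.* b) (α ℤ.* β)
  residue-* {mkℚ _ da _} {mkℚ _ db _} {α} {β} (p∤da , a≈) (p∤db , b≈) =
    residue-/ _ (suc da ℕ.* suc db) (p∤* p∤da p∤db)
      (≈-trans (*-cong-≈ a≈ b≈) (≡⇒≈ (trans (collect α β (+ suc da) (+ suc db)) (cong ((α ℤ.* β) ℤ.*_) (sym (ℤ.pos-* (suc da) (suc db)))))))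
    where
    collect : ∀ α β A B → α ℤ.* A ℤ.* (β ℤ.* B) ≡ (α ℤ.* β) ℤ.* (A ℤ.* B)
    collect = solve-∀

  residue-neg : ∀ {a α} → HasResidue a α → HasResidue (ℚ.- a) (ℤ.- α)
  residue-neg {a} {α} (p∤den , a≈) =
    (λ p∣den → p∤den (subst (p ∣_) (ℤ.+-injective (ℚ.↧-neg a)) p∣den)) ,
    ≈-trans (≡⇒≈ (ℚ.↥-neg a)) (≈-trans (neg-cong-≈ a≈) (≡⇒≈ (trans (ℤ.neg-distribˡ-* α (↧ a)) (cong (ℤ.- α ℤ.*_) (sym (ℚ.↧-neg a))))))

  residue-difference : ∀ {a b α β} → HasResidue a α → HasResidue b β → HasResidue (a ℚ.- b) (α ℤ.- β)
  residue-difference a↦α b↦β = residue-+ a↦α (residue-neg b↦β)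

  residue-^ : ∀ {q ρ} n → HasResidue q ρ → HasResidue (q ^ℚ n) (ρ ℤ.^ n)
  residue-^ zero    q↦ρ = residue-1
  residue-^ (suc n) q↦ρ = residue-* q↦ρ (residue-^ n q↦ρ)

  residue-sum : ∀ m {F : Fin m → ℚ} {G : ℕ → ℤ} → (∀ k → HasResidue (F k) (G (toℕ k))) → HasResidue (sumFin m F) (sumℤ m G)
  residue-sum zero    F↦G = residue-0
  residue-sum (suc m) F↦G = residue-+ (F↦G Fin.zero) (residue-sum m (λ k → F↦G (Fin.suc k)))

  lookup-∷ʳ : ∀ {A : Set} {m} (xs : Vec A m) y (k : Fin (suc m)) →
    (Σ (Fin m) λ j → (toℕ j ≡ toℕ k) × (lookup (xs ∷ʳ y) k ≡ lookup xs j)) ⊎ ((toℕ k ≡ m) × (lookup (xs ∷ʳ y) k ≡ y))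
  lookup-∷ʳ []       y Fin.zero    = inj₂ (refl , refl)
  lookup-∷ʳ (x ∷ xs) y Fin.zero    = inj₁ (Fin.zero , refl , refl)
  lookup-∷ʳ (x ∷ xs) y (Fin.suc k) with lookup-∷ʳ xs y k
  ... | inj₁ (j , j≡k , eq) = inj₁ (Fin.suc j , cong suc j≡k , eq)
  ... | inj₂ (k≡m , eq)     = inj₂ (cong suc k≡m , eq)

  module _ (x : ℚ) (t : ℤ) (x↦t : HasResidue x t) where

    residue-bernStep : ∀ m {v : Vec ℚ m} → suc m ℕ.< p → (∀ k → HasResidue (lookup v k) (bernoulli t (toℕ k))) →
      HasResidue (bernStep x m v) (bernoulli t m)
    residue-bernStep m 1+m<p v↦B = residue-cong (≡⇒≈ (sym (bernoulli-rec t m)))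
      (residue-difference (residue-^ m x↦t) (residue-* (residue-recip (suc m) (0<j<p⇒p∤j (suc m) (s≤s z≤n) 1+m<p))
        (residue-sum m (λ k → residue-* (residue-integer (+ (suc m C toℕ k))) (v↦B k)))))

    residue-bernList : ∀ m → m ℕ.< p → ∀ k → HasResidue (lookup (bernList x m) k) (bernoulli t (toℕ k))
    residue-bernList (suc m) 1+m<p k with lookup-∷ʳ (bernList x m) (bernStep x m (bernList x m)) k
    ... | inj₁ (j , j≡k , eq) = subst₂ HasResidue (sym eq) (cong (bernoulli t) j≡k) (residue-bernList m m<p j)
      where m<p = ℕ.<-trans (ℕ.n<1+n m) 1+m<p
    ... | inj₂ (k≡m , eq)     = subst₂ HasResidue (sym eq) (cong (bernoulli t) (sym k≡m))
                                  (residue-bernStep m {bernList x m} 1+m<p (residue-bernList m (ℕ.<-trans (ℕ.n<1+n m) 1+m<p)))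

    residue-bernoulliPoly : ∀ m → suc m ℕ.< p → HasResidue (bernoulliPoly m x) (bernoulli t m)
    residue-bernoulliPoly m 1+m<p = residue-bernStep m {bernList x m} 1+m<p (residue-bernList m (ℕ.<-trans (ℕ.n<1+n m) 1+m<p))

  residue-0⇒multiple-of-p : ∀ {d} → HasResidue d 0ℤ → ∃ λ (r : ℚ) → (d ≡ ((+ p) / 1) ℚ.* r) × ¬ (p ∣ ↧ₙ r)
  residue-0⇒multiple-of-p {mkℚ N D-1 coprime} (p∤D , num≈0) with ≈-trans num≈0 (≡⇒≈ (ℤ.*-zeroˡ (+ suc D-1)))
  ... | mk K N-0≡Kp = r , d≡p*r , p∤↧r
    where
    r = K / suc D-1
    N≡Kp : N ≡ K ℤ.* + p
    N≡Kp = trans (sym (ℤ.+-identityʳ N)) N-0≡Kp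
    ↧r*gcd≡D : ↧ₙ r ℕ.* gcdℕ ∣ K ∣ (suc D-1) ≡ suc D-1
    ↧r*gcd≡D = ℤ.+-injective (trans (ℤ.pos-* (↧ₙ r) _) (ℚ.↧-/ K (suc D-1)))
    p∤↧r : ¬ (p ∣ ↧ₙ r)
    p∤↧r p∣↧r = p∤D (subst (p ∣_) ↧r*gcd≡D (∣-trans p∣↧r (m∣m*n _)))
    swap : ∀ K P D → K ℤ.* P ℤ.* D ≡ P ℤ.* K ℤ.* D
    swap = solve-∀
    unnormalised : ℚᵘ.mkℚᵘ N D-1 ℚᵘ.≃ (ℚᵘ.mkℚᵘ (+ p) 0 ℚᵘ.* ℚᵘ.mkℚᵘ K D-1)
    unnormalised = ℚᵘ.*≡* (trans (cong₂ ℤ._*_ N≡Kp (cong +_ (ℕ.*-identityˡ (suc D-1)))) (swap K (+ p) (+ suc D-1)))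
    d≡p*r : mkℚ N D-1 coprime ≡ ((+ p) / 1) ℚ.* r
    d≡p*r = ℚ.toℚᵘ-injective (ℚᵘ.≃-trans unnormalised (ℚᵘ.≃-sym (ℚᵘ.≃-trans (ℚ.toℚᵘ-homo-* ((+ p) / 1) r)
      (ℚᵘ.*-cong (ℚ.toℚᵘ-fromℚᵘ (ℚᵘ.mkℚᵘ (+ p) 0)) (ℚ.toℚᵘ-fromℚᵘ (ℚᵘ.mkℚᵘ K D-1))))))

  residues-≈⇒≡[modℚ] : ∀ {a b α β} → HasResidue a α → HasResidue b β → α ≈ β → a ≡ b [modℚ p ]
  residues-≈⇒≡[modℚ] a↦α b↦β α≈β = residue-0⇒multiple-of-p (residue-cong (x≈y⇒x-y≈0 α≈β) (residue-difference a↦α b↦β))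


open import Defs
open import Data.Nat using (ℕ; suc; _+_; _∸_; _^_; _<_; _⊔_; NonZero)
open import Data.Nat.Divisibility using (_∣_)
open import Data.Nat.Primality using (Prime)
open import Data.Integer using (+_)
open import Data.Rational using (ℚ; _/_; -_; _*_; 0ℚ)
open import Data.Product using (_×_)
open import Relation.Nullary using (¬_)

import Data.Nat as ℕ
import Data.Nat.Properties as ℕ
open import Data.Fin using (toℕ)
open import Data.Fin.Properties using (toℕ<n)
open import Data.Product using (_,_)

lemma2p7 : (n p : ℕ) → .{{_ : NonZero n}} → Prime p → (n + 1) ⊔ 3 < p →
    ((2 ∣ n) →
      lhsSum n p ≡ (- ((+ (2 ^ (n + 1) + 4)) / 1)) * ((+ 1) / n) * (((+ 1) / 6) ^ℚ n)
                     * bernoulliPoly (p ∸ n) ((+ 1) / 3) [modℚ p ])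
    × (¬ (2 ∣ n) → lhsSum n p ≡ 0ℚ [modℚ p ])
lemma2p7 n p p-prime bound = even , odd
  where
  3<p : 3 < p
  3<p = ℕ.≤-<-trans (ℕ.m≤n⊔m (n + 1) 3) bound
  n+1<p : n + 1 < p
  n+1<p = ℕ.≤-<-trans (ℕ.m≤m⊔n (n + 1) 3) bound
  open AlternatingSum p p-prime 3<p
  open Residues p p-prime 2<p
  open Fermat p p-prime using (0<j<p⇒p∤j)
  open SignedLegendre using (signedLegendre)
  p∤ : ∀ j .{{_ : NonZero j}} → j < p → ¬ (p ∣ j)
  p∤ j = 0<j<p⇒p∤j j (ℕ.>-nonZero⁻¹ j)
  lhs-residue : HasResidue (lhsSum n p) (alternatingSum n)
  lhs-residue = residue-sum (p ∸ 1) λ k → residue-* (residue-integer (signedLegendre (p + suc (toℕ k))))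
    (residue-^ n (residue-recip (suc (toℕ k)) (p∤ (suc (toℕ k)) (i<p-1⇒1+i<p (toℕ<n k)))))
  even : 2 ∣ n → lhsSum n p ≡ (- ((+ (2 ^ (n + 1) + 4)) / 1)) * ((+ 1) / n) * (((+ 1) / 6) ^ℚ n)
                              * bernoulliPoly (p ∸ n) ((+ 1) / 3) [modℚ p ]
  even 2∣n = residues-≈⇒≡[modℚ] lhs-residue
    (residue-* (residue-* (residue-* (residue-neg (residue-integer (+ (2 ^ (n + 1) + 4))))
                                     (residue-recip n (p∤ n (ℕ.≤-<-trans (ℕ.m≤m+n n 1) n+1<p))))
                          (residue-^ n (residue-recip 6 p∤6)))
               (residue-bernoulliPoly ((+ 1) / 3) third (residue-recip 3 (p∤ 3 3<p)) (p ∸ n) (even⇒1+[p∸n]<p n 2∣n)))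
    (alternatingSum-even n 2∣n n+1<p)
  odd : ¬ (2 ∣ n) → lhsSum n p ≡ 0ℚ [modℚ p ]
  odd 2∤n = residues-≈⇒≡[modℚ] lhs-residue residue-0 (alternatingSum-odd n 2∤n)
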